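{- (a) Every path admits a $1$-clique-colorable $2$-track layout. (b) Every tree admits a $2$-clique-colorable $3$-track layout. (c) Every outerplanar graph admits a $2$-clique-colorable $5$-track layout.
   Context: All graphs are finite, simple and undirected. A $t$-track assignment of a graph $G=(V,E)$ is a partition of $V$ into $t$ sets $V_1,\dots,V_t$ (tracks), each an independent set of $G$, together with a total order $<_i$ on each $V_i$. An X-crossing consists of two edges $(u,v)$ and $(x,y)$ with $u,x\in V_i$, $v,y\in V_j$ ($i\neq j$), $u<_i x$ and $y<_j v$. A $t$-track layout is a $t$-track assignment with no X-crossing. Given a $t$-track layout of $G$, a clique $C_1$ precedes a clique $C_2$ (written $C_1\prec C_2$) if for every $1\le i\le t$ and all $u\in V_i\cap C_1$, $w\in V_i\cap C_2$ one has $u\le_i w$. A set $S$ of maximal cliques of $G$ is nicely ordered if $\prec$ is a total order on $S$, i.e. its elements can be listed $C_1,\dots,C_{|S|}$ with $C_i\prec C_j$ for all $i<j$. The track layout is $c$-clique-colorable if the set of maximal cliques of $G$ can be partitioned into $c$ nicely ordered subsets. A graph is outerplanar if it has a planar drawing with all vertices on the outer face. -}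

module Defs where

open import Data.Nat using (ℕ; zero; suc; _<_; _≤_)
open import Data.Fin using (Fin; toℕ; inject₁; fromℕ) renaming (zero to fzero; suc to fsuc)
open import Data.Fin.Subset using (Subset; _∈_; _∉_)
open import Data.Bool using (Bool; true; false)
open import Data.Product using (Σ; ∃; _×_; _,_)
open import Data.Sum using (_⊎_)
open import Data.Empty using (⊥)
open import Data.List using (List)
import Data.List.Membership.Propositional as LM
open import Data.List.Relation.Unary.AllPairs using (AllPairs)
open import Data.List.Relation.Unary.Unique.Propositional using (Unique)
open import Relation.Nullary using (¬_)
open import Relation.Binary.PropositionalEquality using (_≡_; _≢_)
open import Function.Definitions using (Injective; Bijective)

record Graph : Set where
  field
    n      : ℕ
    adj    : Fin n → Fin n → Bool
    sym    : ∀ u v → adj u v ≡ adj v u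
    irrefl : ∀ u → adj u u ≡ false

open Graph public

V : Graph → Set
V G = Fin (n G)

Edge : (G : Graph) → V G → V G → Set
Edge G u v = adj G u v ≡ true

-- Tracks are given by `track`; the total order <_i on
-- track V_i is  u <_i x  iff  rank u < rank x  (rank is injective on
-- each track, so this is a strict total order on each track).

record TrackLayout (G : Graph) (t : ℕ) : Set where
  field
    track    : V G → Fin t
    rank     : V G → ℕ
    rank-inj : ∀ u v → track u ≡ track v → rank u ≡ rank v → u ≡ v
    indep    : ∀ u v → Edge G u v → track u ≢ track v
    noX      : ∀ u v x y → Edge G u v → Edge G x y →
               track u ≡ track x → track v ≡ track y → track u ≢ track v →
               rank u < rank x → rank y < rank v → ⊥

open TrackLayout public

IsClique : (G : Graph) → Subset (n G) → Set
IsClique G C = ∀ u v → u ∈ C → v ∈ C → u ≢ v → Edge G u v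

IsMaximalClique : (G : Graph) → Subset (n G) → Set
IsMaximalClique G C =
  IsClique G C × (∀ w → w ∉ C → Σ (V G) λ u → u ∈ C × ¬ Edge G u w)

Precedes : {G : Graph} {t : ℕ} → TrackLayout G t → Subset (n G) → Subset (n G) → Set
Precedes {G} L C₁ C₂ =
  ∀ u w → u ∈ C₁ → w ∈ C₂ → track L u ≡ track L w → rank L u ≤ rank L w

-- A (finite) set S of maximal cliques, given as a duplicate-free list, is
-- nicely ordered if it can be listed C₁,…,C_|S| with Cᵢ ≺ Cⱼ for i < j.
NicelyOrderedListing : {G : Graph} {t : ℕ} → TrackLayout G t → List (Subset (n G)) → Set
NicelyOrderedListing L S = Unique S × AllPairs (Precedes L) S

-- The layout is c-clique-colorable: the set of maximal cliques is
-- partitioned into c (possibly empty) nicely ordered subsets.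
CliqueColorable : {G : Graph} {t : ℕ} → TrackLayout G t → ℕ → Set
CliqueColorable {G} L c =
  Σ (Fin c → List (Subset (n G))) λ part →
    (∀ k → NicelyOrderedListing L (part k)) ×
    (∀ k C → C LM.∈ part k → IsMaximalClique G C) ×
    (∀ C → IsMaximalClique G C →
       Σ (Fin c) λ k → C LM.∈ part k × (∀ k' → C LM.∈ part k' → k' ≡ k))

IsPath : Graph → Set
IsPath G =
  Σ (Fin (n G) → V G) λ σ → Bijective _≡_ _≡_ σ ×
    (∀ i j → (Edge G (σ i) (σ j) → (suc (toℕ i) ≡ toℕ j ⊎ suc (toℕ j) ≡ toℕ i))
           × ((suc (toℕ i) ≡ toℕ j ⊎ suc (toℕ j) ≡ toℕ i) → Edge G (σ i) (σ j)))

data Walk (G : Graph) : V G → V G → Set where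
  here : ∀ {u} → Walk G u u
  step : ∀ {u w v} → Edge G u w → Walk G w v → Walk G u v

Connected : Graph → Set
Connected G = ∀ u v → Walk G u v

HasCycle : Graph → Set
HasCycle G =
  Σ ℕ λ k → Σ (Fin (3 Data.Nat.+ k) → V G) λ f → Injective _≡_ _≡_ f ×
    (∀ (i : Fin (2 Data.Nat.+ k)) → Edge G (f (inject₁ i)) (f (fsuc i))) ×
    Edge G (f (fromℕ (2 Data.Nat.+ k))) (f fzero)

IsTree : Graph → Set
IsTree G = Connected G × ¬ HasCycle G

-- Outerplanar: the vertices can be placed on a circle in some cyclic
-- order π(0),…,π(n-1) so that no two edges, drawn as chords, cross.
IsOuterplanar : Graph → Set
IsOuterplanar G =
  Σ (Fin (n G) → V G) λ π → Bijective _≡_ _≡_ π ×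
    (∀ a b c d → toℕ a < toℕ b → toℕ b < toℕ c → toℕ c < toℕ d →
       Edge G (π a) (π c) → Edge G (π b) (π d) → ⊥)

{-# OPTIONS --safe #-}
module Submission where

-- All three layouts put vertex v on track level(v) mod t and rank it first by level, where
-- every edge joins two different levels at most s apart with 2 s < t; then two crossing edges
-- must join the same pair of levels, and only that case needs a real argument.
--
-- Paths: the level is the position along the path (here t = 2 and the crossing is excluded by
-- hand); the maximal cliques are the edges, listed from left to right.
--
-- Trees: the level is the depth below a root, t = 3, and within a level vertices are ordered by
-- the numeral spelling their root path, so children inherit the order of their parents.
-- Acyclicity makes every edge join a vertex to its parent, and the edges, colored by the parity
-- of the child's depth and listed by the child's rank, form two nicely ordered classes.
--
-- Outerplanar graphs: number the vertices around the outer face and split the chord (0, n - 1)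
-- recursively at its apex, the last neighbour of its left end below its right end.
-- Outerplanarity makes every edge a chord of this decomposition. Levels are assigned down the
-- decomposition so that the ends of a chord lie on different levels at most 2 apart, one of them
-- strictly below everything between them; with t = 5 this rules out crossings between edges
-- on a common pair of levels. The maximal cliques (triangles, chords, isolated vertices) are
-- listed by a traversal of the decomposition, arranged at each node so that positions on a
-- common level increase; grouped by blocks of two levels and colored by the parity of the
-- block, they form two nicely ordered classes.

open import Defs renaming (sym to adj-sym)
open import Data.Bool using (true)
import Data.Bool as Bool
open import Data.Empty using (⊥; ⊥-elim)
open import Data.Fin as Fin using (Fin; toℕ; fromℕ; fromℕ<; inject₁)
import Data.Fin.Properties as Finₚ
open import Data.Fin.Subset using (Subset; _∈_; _∉_; ⊤)
import Data.Fin.Subset.Properties as Subsetₚ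
open import Data.List using (List; []; _∷_; _++_; filter; deduplicate; map; upTo; allFin)
open import Data.List.Extrema.Nat using (min; max; max≈v⁺; min≤xs; xs≤max; v≤min⁺)
open import Data.List.Membership.Propositional using () renaming (_∈_ to _∈ₗ_)
open import Data.List.Membership.Propositional.Properties
  using (∈-filter⁺; ∈-filter⁻; ∈-deduplicate⁺; ∈-deduplicate⁻; ∈-++⁺ˡ; ∈-++⁺ʳ; ∈-++⁻; ∈-map⁺;
         ∈-upTo⁺; ∈-upTo⁻; ∈-allFin)
open import Data.List.Relation.Unary.Any using (here; there)
open import Data.List.Relation.Unary.Any.Properties using (¬Any[])
open import Data.List.Relation.Unary.All as All using (All; []; _∷_)
import Data.List.Relation.Unary.All.Properties as Allₚ
open import Data.List.Relation.Unary.AllPairs as AllPairs using (AllPairs; []; _∷_)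
import Data.List.Relation.Unary.AllPairs.Properties as AllPairsₚ
import Data.List.Relation.Unary.Unique.DecPropositional.Properties as UniqueDecₚ
open import Data.Nat
  using (ℕ; zero; suc; _+_; _*_; _∸_; _^_; _≤_; _<_; z≤n; s≤s; NonZero; >-nonZero; _≟_; _≤?_; _<?_)
open import Data.Nat.DivMod using (_mod_; _%_; _/_; m≡m%n+[m/n]*n; /-monoˡ-≤; m%n<n; m/n*n≤m)
open import Data.Nat.ListAction using (sum)
open import Data.Nat.Properties
open import Data.List.Membership.DecPropositional _≟_ using () renaming (_∈?_ to _∈ₗ?_)
open import Data.Product using (Σ; ∃; _×_; _,_; proj₁; proj₂)
open import Data.Sum using (_⊎_; inj₁; inj₂; [_,_]; [_,_]′)
open import Data.Vec using (tabulate)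
import Data.Vec.Properties as Vecₚ
open import Function using (id)
import Function.Construct.Identity as Identity
open import Function.Definitions using (Bijective)
open import Relation.Binary.Definitions using (DecidableEquality; tri<; tri≈; tri>)
open import Relation.Binary.PropositionalEquality hiding ([_]; J)
open import Relation.Nullary using (¬_; Dec; yes; no; contradiction)
open import Relation.Nullary.Decidable using (_×-dec_; _→-dec_; _⊎-dec_; ¬?; does; dec-true)
open import Relation.Unary using (Decidable)

edge-sym : ∀ (G : Graph) {u v} → Edge G u v → Edge G v u
edge-sym G {u} {v} e = trans (adj-sym G v u) e

edge-irrefl : ∀ (G : Graph) {u} → ¬ Edge G u u
edge-irrefl G {u} e = contradiction (trans (sym e) (irrefl G u)) λ ()

mod-gap : ∀ k .{{_ : NonZero k}} {m m′} → m mod k ≡ m′ mod k → m < m′ → m + k ≤ m′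
mod-gap k {m} {m′} eq m<m′ = begin
  m + k                    ≡⟨ cong (_+ k) (m≡m%n+[m/n]*n m k) ⟩
  m % k + m / k * k + k    ≡⟨ +-assoc (m % k) _ k ⟩
  m % k + (m / k * k + k)  ≡⟨ cong (m % k +_) (+-comm (m / k * k) k) ⟩
  m % k + suc (m / k) * k  ≤⟨ +-mono-≤ (≤-reflexive same%) (*-monoˡ-≤ k q<q′) ⟩
  m′ % k + m′ / k * k      ≡⟨ m≡m%n+[m/n]*n m′ k ⟨
  m′                       ∎
  where
  open ≤-Reasoning
  same% : m % k ≡ m′ % k
  same% = trans (sym (Finₚ.toℕ-fromℕ< _)) (trans (cong toℕ eq) (Finₚ.toℕ-fromℕ< _))
  q<q′ : m / k < m′ / k
  q<q′ = ≤∧≢⇒< (/-monoˡ-≤ k (<⇒≤ m<m′)) λ q≡q′ → <⇒≢ m<m′ (begin-equality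
    m                    ≡⟨ m≡m%n+[m/n]*n m k ⟩
    m % k + m / k * k    ≡⟨ cong₂ (λ r q → r + q * k) same% q≡q′ ⟩
    m′ % k + m′ / k * k  ≡⟨ m≡m%n+[m/n]*n m′ k ⟨
    m′                   ∎)

lex-< : ∀ k {a b p q} → a < b → p < k → a * k + p < b * k + q
lex-< k {a} {b} {p} {q} a<b p<k = begin-strict
  a * k + p   <⟨ +-monoʳ-< (a * k) p<k ⟩
  a * k + k   ≡⟨ +-comm (a * k) k ⟩
  suc a * k   ≤⟨ *-monoˡ-≤ k a<b ⟩
  b * k       ≤⟨ m≤m+n (b * k) q ⟩
  b * k + q   ∎
  where open ≤-Reasoning

lex-≤ : ∀ k {a b p q} → a * k + p < b * k + q → q < k → a ≤ b
lex-≤ k lt q<k = ≮⇒≥ λ b<a → <-asym lt (lex-< k b<a q<k)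

lex-injective : ∀ k {a b p q} → p < k → q < k → a * k + p ≡ b * k + q → a ≡ b × p ≡ q
lex-injective k {a} {b} {p} {q} p<k q<k eq with <-cmp a b
... | tri< a<b _ _ = contradiction eq (<⇒≢ (lex-< k a<b p<k))
... | tri> _ _ b<a = contradiction (sym eq) (<⇒≢ (lex-< k b<a q<k))
... | tri≈ _ refl _ = refl , +-cancelˡ-≡ (a * k) p q eq

module _ {A : Set} where

  AllPairs-restrict : ∀ {P : A → Set} {R S : A → A → Set} {xs} →
    (∀ {x y} → P x → P y → R x y → S x y) → All P xs → AllPairs R xs → AllPairs S xs
  AllPairs-restrict f [] [] = []
  AllPairs-restrict f (px ∷ pxs) (rx ∷ rxs) =
    All.zipWith (λ (py , r) → f px py r) (pxs , rx) ∷ AllPairs-restrict f pxs rxs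

  AllPairs-++⁺ : ∀ {R : A → A → Set} {xs ys} → AllPairs R xs → AllPairs R ys →
    (∀ {x y} → x ∈ₗ xs → y ∈ₗ ys → R x y) → AllPairs R (xs ++ ys)
  AllPairs-++⁺ rxs rys across =
    AllPairsₚ.++⁺ rxs rys (All.tabulate λ x∈ → All.tabulate λ y∈ → across x∈ y∈)

  AllPairs-deduplicate⁺ : ∀ {R : A → A → Set} (_≟ᴬ_ : DecidableEquality A) {xs} →
    AllPairs R xs → AllPairs R (deduplicate _≟ᴬ_ xs)
  AllPairs-deduplicate⁺ _≟ᴬ_ [] = []
  AllPairs-deduplicate⁺ _≟ᴬ_ {x ∷ xs} (rx ∷ rxs) =
    Allₚ.filter⁺ _ (All.tabulate λ y∈ → All.lookup rx (∈-deduplicate⁻ _≟ᴬ_ xs y∈))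
    ∷ AllPairsₚ.filter⁺ _ (AllPairs-deduplicate⁺ _≟ᴬ_ rxs)

∈⇒≤sum : ∀ {m ns} → m ∈ₗ ns → m ≤ sum ns
∈⇒≤sum {ns = m ∷ ns} (here refl) = m≤m+n m (sum ns)
∈⇒≤sum {ns = m ∷ ns} (there m∈) = ≤-trans (∈⇒≤sum m∈) (m≤n+m (sum ns) m)

-- A stable sort by a natural-number key: elements with equal keys keep their relative order.
module BucketSort {A : Set} (key : A → ℕ) where

  bucket : ℕ → List A → List A
  bucket k = filter (λ x → key x ≟ k)

  buckets : ℕ → ℕ → List A → List A
  buckets k zero    xs = []
  buckets k (suc j) xs = bucket k xs ++ buckets (suc k) j xs

  bucketSort : List A → List A
  bucketSort xs = buckets 0 (suc (sum (map key xs))) xs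

  ∈-buckets⁻ : ∀ k j {x xs} → x ∈ₗ buckets k j xs → x ∈ₗ xs × k ≤ key x
  ∈-buckets⁻ k (suc j) {xs = xs} x∈ with ∈-++⁻ (bucket k xs) x∈
  ... | inj₁ x∈b  = let x∈xs , kx≡k = ∈-filter⁻ (λ x → key x ≟ k) {xs = xs} x∈b in x∈xs , ≤-reflexive (sym kx≡k)
  ... | inj₂ x∈bs = let x∈xs , k<kx = ∈-buckets⁻ (suc k) j x∈bs in x∈xs , <⇒≤ k<kx

  ∈-buckets⁺ : ∀ k j {x xs} → x ∈ₗ xs → k ≤ key x → key x < k + j → x ∈ₗ buckets k j xs
  ∈-buckets⁺ k zero    x∈ k≤kx kx<k+0 = contradiction (≤-trans kx<k+0 (≤-reflexive (+-identityʳ k))) (≤⇒≯ k≤kx)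
  ∈-buckets⁺ k (suc j) {x} {xs} x∈ k≤kx kx<k+j with k ≟ key x
  ... | yes refl = ∈-++⁺ˡ (∈-filter⁺ (λ x → key x ≟ k) x∈ refl)
  ... | no k≢kx  = ∈-++⁺ʳ (bucket k xs)
                     (∈-buckets⁺ (suc k) j x∈ (≤∧≢⇒< k≤kx k≢kx) (subst (key x <_) (+-suc k j) kx<k+j))

  buckets-AllPairs : ∀ {R : A → A → Set} {xs} → AllPairs (λ x y → key x ≡ key y → R x y) xs →
    (∀ {x y} → key x < key y → R x y) → ∀ k j → AllPairs R (buckets k j xs)
  buckets-AllPairs same lower k zero = []
  buckets-AllPairs {R} {xs} same lower k (suc j) =
    AllPairs-++⁺ inBucket (buckets-AllPairs same lower (suc k) j) across
    where
    inBucket : AllPairs R (bucket k xs)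
    inBucket = AllPairs-restrict (λ kx≡k ky≡k r → r (trans kx≡k (sym ky≡k)))
                 (Allₚ.all-filter (λ x → key x ≟ k) xs) (AllPairsₚ.filter⁺ _ same)
    across : ∀ {x y} → x ∈ₗ bucket k xs → y ∈ₗ buckets (suc k) j xs → R x y
    across {y = y} x∈ y∈ = lower (subst (_< key y) (sym (proj₂ (∈-filter⁻ (λ x → key x ≟ k) {xs = xs} x∈)))
                                        (proj₂ (∈-buckets⁻ (suc k) j y∈)))

  ∈-bucketSort⁺ : ∀ {x xs} → x ∈ₗ xs → x ∈ₗ bucketSort xs
  ∈-bucketSort⁺ x∈ = ∈-buckets⁺ 0 _ x∈ z≤n (s≤s (∈⇒≤sum (∈-map⁺ key x∈)))

  bucketSort-AllPairs : ∀ {R : A → A → Set} {xs} → AllPairs (λ x y → key x ≡ key y → R x y) xs →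
    (∀ {x y} → key x < key y → R x y) → AllPairs R (bucketSort xs)
  bucketSort-AllPairs {xs = xs} same lower = buckets-AllPairs same lower 0 (suc (sum (map key xs)))

_≟ˢ_ : ∀ {m} → DecidableEquality (Subset m)
_≟ˢ_ = Vecₚ.≡-dec Bool._≟_

isMaximalClique? : (G : Graph) (C : Subset (n G)) → Dec (IsMaximalClique G C)
isMaximalClique? G C =
  (Finₚ.all? λ u → Finₚ.all? λ v →
     u Subsetₚ.∈? C →-dec (v Subsetₚ.∈? C →-dec (¬? (u Fin.≟ v) →-dec (adj G u v Bool.≟ true))))
  ×-dec (Finₚ.all? λ w → ¬? (w Subsetₚ.∈? C) →-dec
           Finₚ.any? λ u → u Subsetₚ.∈? C ×-dec ¬? (adj G u w Bool.≟ true))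

module _ {G : Graph} {t : ℕ} (L : TrackLayout G t) where

  clique-precedes-itself : ∀ {C} → IsClique G C → Precedes L C C
  clique-precedes-itself clique u w u∈ w∈ same with u Fin.≟ w
  ... | yes refl = ≤-refl
  ... | no u≢w   = contradiction same (indep L u w (clique u w u∈ w∈ u≢w))

  SameClassPrecedes : ∀ {c} → (Subset (n G) → Fin c) → Subset (n G) → Subset (n G) → Set
  SameClassPrecedes cls X Y = IsMaximalClique G X → IsMaximalClique G Y → cls X ≡ cls Y → Precedes L X Y

  -- Candidates that are not maximal cliques are harmless: they are filtered out.
  cliqueColorable : ∀ c (cls : Subset (n G) → Fin c) (T : List (Subset (n G))) →
    (∀ C → IsMaximalClique G C → C ∈ₗ T) → AllPairs (SameClassPrecedes cls) T → CliqueColorable L c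
  cliqueColorable c cls T complete ordered = part , listing , maximal , classOf
    where
    InClass : Fin c → Subset (n G) → Set
    InClass k X = IsMaximalClique G X × cls X ≡ k

    inClass? : ∀ k X → Dec (InClass k X)
    inClass? k X = isMaximalClique? G X ×-dec (cls X Fin.≟ k)

    part : Fin c → List (Subset (n G))
    part k = deduplicate _≟ˢ_ (filter (inClass? k) T)

    ∈-part⁻ : ∀ {k C} → C ∈ₗ part k → InClass k C
    ∈-part⁻ {k} C∈ = proj₂ (∈-filter⁻ (inClass? k) {xs = T} (∈-deduplicate⁻ _≟ˢ_ _ C∈))

    listing : ∀ k → NicelyOrderedListing L (part k)
    listing k = UniqueDecₚ.deduplicate-! _≟ˢ_ _ ,
      AllPairs-deduplicate⁺ _≟ˢ_
        (AllPairs-restrict sameClass (Allₚ.all-filter (inClass? k) T) (AllPairsₚ.filter⁺ (inClass? k) ordered))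
      where
      sameClass : ∀ {X Y} → InClass k X → InClass k Y → SameClassPrecedes cls X Y → Precedes L X Y
      sameClass (maxX , clsX) (maxY , clsY) r = r maxX maxY (trans clsX (sym clsY))

    maximal : ∀ k C → C ∈ₗ part k → IsMaximalClique G C
    maximal k C C∈ = proj₁ (∈-part⁻ C∈)

    classOf : ∀ C → IsMaximalClique G C → Σ (Fin c) λ k → C ∈ₗ part k × (∀ k′ → C ∈ₗ part k′ → k′ ≡ k)
    classOf C maxC = cls C ,
      ∈-deduplicate⁺ _≟ˢ_ (∈-filter⁺ (inClass? (cls C)) (complete C maxC) (maxC , refl)) ,
      λ k′ C∈ → sym (proj₂ (∈-part⁻ C∈))

Fin≤1-irrelevant : ∀ {m} → m ≤ 1 → (i j : Fin m) → i ≡ j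
Fin≤1-irrelevant {suc zero} _ Fin.zero Fin.zero = refl
Fin≤1-irrelevant {suc (suc _)} (s≤s ()) _ _

≤1-vertex-layout : (G : Graph) {t c : ℕ} → n G ≤ 1 → Σ (TrackLayout G (suc t)) λ L → CliqueColorable L (suc c)
≤1-vertex-layout G {t} {c} n≤1 = L , cliqueColorable L (suc c) (λ _ → Fin.zero) (⊤ ∷ []) onlyClique ([] ∷ [])
  where
  noEdge : ∀ u v → ¬ Edge G u v
  noEdge u v e rewrite Fin≤1-irrelevant n≤1 u v = edge-irrefl G e

  L : TrackLayout G (suc t)
  L = record { track = λ _ → Fin.zero ; rank = toℕ ; rank-inj = λ _ _ _ → Finₚ.toℕ-injective
             ; indep = λ u v e _ → noEdge u v e ; noX = λ u v _ _ e _ _ _ _ _ _ → noEdge u v e }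

  onlyClique : ∀ C → IsMaximalClique G C → C ∈ₗ ⊤ ∷ []
  onlyClique C (_ , maximal) = here (Subsetₚ.⊆-antisym Subsetₚ.⊆⊤ ⊤⊆C)
    where
    ⊤⊆C : ∀ {w} → w ∈ ⊤ → w ∈ C
    ⊤⊆C {w} _ with w Subsetₚ.∈? C
    ... | yes w∈ = w∈
    ... | no w∉  = let u , u∈ , _ = maximal w w∉ in subst (_∈ C) (Fin≤1-irrelevant n≤1 u w) u∈

module Numbering (G : Graph) (π : Fin (n G) → V G) (π-bij : Bijective _≡_ _≡_ π) (default : Fin (n G)) where

  π⁻¹ : V G → Fin (n G)
  π⁻¹ v = proj₁ (proj₂ π-bij v)

  π-π⁻¹ : ∀ v → π (π⁻¹ v) ≡ v
  π-π⁻¹ v = proj₂ (proj₂ π-bij v) refl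

  π⁻¹-π : ∀ i → π⁻¹ (π i) ≡ i
  π⁻¹-π i = proj₁ π-bij (π-π⁻¹ (π i))

  -- Numbers out of range are sent to the default index.
  index : ℕ → Fin (n G)
  index p with p <? n G
  ... | yes p<n = fromℕ< p<n
  ... | no _    = default

  toℕ-index : ∀ {p} → p < n G → toℕ (index p) ≡ p
  toℕ-index {p} p<n with p <? n G
  ... | yes _   = Finₚ.toℕ-fromℕ< _
  ... | no p≮n = contradiction p<n p≮n

  index-toℕ : ∀ i → index (toℕ i) ≡ i
  index-toℕ i = Finₚ.toℕ-injective (toℕ-index (Finₚ.toℕ<n i))

  pos : V G → ℕ
  pos v = toℕ (π⁻¹ v)

  at : ℕ → V G
  at p = π (index p)

  pos<n : ∀ v → pos v < n G
  pos<n v = Finₚ.toℕ<n (π⁻¹ v)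

  at-pos : ∀ v → at (pos v) ≡ v
  at-pos v = trans (cong π (index-toℕ (π⁻¹ v))) (π-π⁻¹ v)

  pos-at : ∀ {p} → p < n G → pos (at p) ≡ p
  pos-at p<n = trans (cong toℕ (π⁻¹-π _)) (toℕ-index p<n)

  pos-injective : ∀ {u v} → pos u ≡ pos v → u ≡ v
  pos-injective {u} {v} eq = trans (sym (at-pos u)) (trans (cong at eq) (at-pos v))

  atPositions : List ℕ → Subset (n G)
  atPositions ps = tabulate λ v → does (pos v ∈ₗ? ps)

  ∈-atPositions⁺ : ∀ {u ps} → pos u ∈ₗ ps → u ∈ atPositions ps
  ∈-atPositions⁺ {u} {ps} p∈ =
    Vecₚ.lookup⇒[]= u _ (trans (Vecₚ.lookup∘tabulate _ u) (dec-true (pos u ∈ₗ? ps) p∈))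

  ∈-atPositions⁻ : ∀ {u} ps → u ∈ atPositions ps → pos u ∈ₗ ps
  ∈-atPositions⁻ {u} ps u∈ with pos u ∈ₗ? ps | trans (sym (Vecₚ.lookup∘tabulate _ u)) (Vecₚ.[]=⇒lookup u∈)
  ... | yes p∈ | _ = p∈
  ... | no _   | ()

  atPositions-swap : ∀ p q → atPositions (p ∷ q ∷ []) ≡ atPositions (q ∷ p ∷ [])
  atPositions-swap p q = Subsetₚ.⊆-antisym (λ u∈ → ∈-atPositions⁺ (swap (∈-atPositions⁻ _ u∈)))
                                            (λ u∈ → ∈-atPositions⁺ (swap (∈-atPositions⁻ _ u∈)))
    where
    swap : ∀ {a b r : ℕ} → r ∈ₗ a ∷ b ∷ [] → r ∈ₗ b ∷ a ∷ []
    swap (here eq)         = there (here eq)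
    swap (there (here eq)) = here eq

  positions : Subset (n G) → List ℕ
  positions C = filter (λ p → at p Subsetₚ.∈? C) (upTo (n G))

  positions-increasing : ∀ C → AllPairs _<_ (positions C)
  positions-increasing C = AllPairsₚ.filter⁺ _ (AllPairsₚ.applyUpTo⁺₁ id (n G) λ i<j _ → i<j)

  ∈-positions⁺ : ∀ {C u} → u ∈ C → pos u ∈ₗ positions C
  ∈-positions⁺ {C} {u} u∈ =
    ∈-filter⁺ (λ p → at p Subsetₚ.∈? C) (∈-upTo⁺ (pos<n u)) (subst (_∈ C) (sym (at-pos u)) u∈)

  ∈-positions⁻ : ∀ {C p} → p ∈ₗ positions C → p < n G × at p ∈ C
  ∈-positions⁻ {C} p∈ = let p∈upTo , at∈ = ∈-filter⁻ (λ p → at p Subsetₚ.∈? C) {xs = upTo (n G)} p∈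
                        in ∈-upTo⁻ p∈upTo , at∈

  pos-at-positions : ∀ {C p} → p ∈ₗ positions C → pos (at p) ≡ p
  pos-at-positions p∈ = pos-at (proj₁ (∈-positions⁻ p∈))

  atPositions-positions : ∀ C → atPositions (positions C) ≡ C
  atPositions-positions C = Subsetₚ.⊆-antisym
    (λ {u} u∈ → subst (_∈ C) (at-pos u) (proj₂ (∈-positions⁻ (∈-atPositions⁻ (positions C) u∈))))
    (λ u∈ → ∈-atPositions⁺ (∈-positions⁺ u∈))

  clique-at-adjacent : ∀ {C p q} → IsClique G C → p < n G × at p ∈ C → q < n G × at q ∈ C → p < q →
                       Edge G (at p) (at q)
  clique-at-adjacent clique (p<n , p∈) (q<n , q∈) p<q =
    clique _ _ p∈ q∈ λ eq → <⇒≢ p<q (trans (sym (pos-at p<n)) (trans (cong pos eq) (pos-at q<n)))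

module Levelled (G : Graph) (t span : ℕ) .{{_ : NonZero t}} (2span<t : span + span < t)
  (level rank : V G → ℕ)
  (rank-injective : ∀ {u v} → rank u ≡ rank v → u ≡ v)
  (rank-levelwise : ∀ {u v} → level u < level v → rank u < rank v)
  (edge-level≢ : ∀ {u v} → Edge G u v → level u ≢ level v)
  (edge-span : ∀ {u v} → Edge G u v → level v ≤ span + level u)
  where

  trackOf : V G → Fin t
  trackOf v = level v mod t

  rank-level-≤ : ∀ {u v} → rank u < rank v → level u ≤ level v
  rank-level-≤ r = ≮⇒≥ λ lv<lu → <-asym r (rank-levelwise lv<lu)

  sameTrack⇒sameLevel : ∀ {u w} → trackOf u ≡ trackOf w →
                        level u < t + level w → level w < t + level u → level u ≡ level w
  sameTrack⇒sameLevel {u} {w} same lu< lw< with <-cmp (level u) (level w)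
  ... | tri≈ _ eq _    = eq
  ... | tri< lu<lw _ _ = contradiction (mod-gap t same lu<lw) (<⇒≱ (subst (level w <_) (+-comm t (level u)) lw<))
  ... | tri> _ _ lw<lu = contradiction (mod-gap t (sym same) lw<lu) (<⇒≱ (subst (level u <_) (+-comm t (level w)) lu<))

  edge-close : ∀ {u v} → Edge G u v → level v < t + level u
  edge-close {u} e = ≤-<-trans (edge-span e) (+-monoˡ-< (level u) (≤-<-trans (m≤m+n span span) 2span<t))

  trackOf-indep : ∀ {u v} → Edge G u v → trackOf u ≢ trackOf v
  trackOf-indep e same = edge-level≢ e (sameTrack⇒sameLevel same (edge-close (edge-sym G e)) (edge-close e))

  private
    gap : ∀ {a b c d} → a + t ≤ b → c ≤ span + a → b ≤ span + d → c < d
    gap {a} {b} {c} {d} a+t≤b c≤ b≤ = +-cancelʳ-< t c d (begin-strict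
      c + t              ≤⟨ +-monoˡ-≤ t c≤ ⟩
      span + a + t       ≡⟨ +-assoc span a t ⟩
      span + (a + t)     ≤⟨ +-monoʳ-≤ span a+t≤b ⟩
      span + b           ≤⟨ +-monoʳ-≤ span b≤ ⟩
      span + (span + d)  ≡⟨ +-assoc span span d ⟨
      span + span + d    <⟨ +-monoˡ-< d 2span<t ⟩
      t + d              ≡⟨ +-comm t d ⟩
      d + t              ∎)
      where open ≤-Reasoning

  lowerStart⇒lowerEnd : ∀ {u v x y} → Edge G u v → Edge G x y → trackOf u ≡ trackOf x → level u < level x → level v < level y
  lowerStart⇒lowerEnd e₁ e₂ same lu<lx = gap (mod-gap t same lu<lx) (edge-span e₁) (edge-span (edge-sym G e₂))

  crossing-sameLevels : ∀ {u v x y} → Edge G u v → Edge G x y → trackOf u ≡ trackOf x → trackOf v ≡ trackOf y →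
                        rank u < rank x → rank y < rank v → level u ≡ level x × level v ≡ level y
  crossing-sameLevels e₁ e₂ t₁ t₂ r₁ r₂ =
    ≤-antisym (rank-level-≤ r₁) (≮⇒≥ λ lu<lx → <-asym r₂ (rank-levelwise (lowerStart⇒lowerEnd e₁ e₂ t₁ lu<lx))) ,
    sym (≤-antisym (rank-level-≤ r₂)
           (≮⇒≥ λ ly<lv → <-asym r₁ (rank-levelwise (lowerStart⇒lowerEnd (edge-sym G e₂) (edge-sym G e₁) (sym t₂) ly<lv))))

  SameLevelCrossingFree : Set
  SameLevelCrossingFree = ∀ {u v x y} → Edge G u v → Edge G x y → level u ≡ level x → level v ≡ level y →
                          rank u < rank x → rank y < rank v → ⊥

  module _ (crossingFree : SameLevelCrossingFree) where

    layout : TrackLayout G t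
    layout = record
      { track    = trackOf
      ; rank     = rank
      ; rank-inj = λ _ _ _ → rank-injective
      ; indep    = λ _ _ → trackOf-indep
      ; noX      = λ _ _ _ _ e₁ e₂ t₁ t₂ _ r₁ r₂ →
                     let ux , vy = crossing-sameLevels e₁ e₂ t₁ t₂ r₁ r₂ in crossingFree e₁ e₂ ux vy r₁ r₂
      }

    precedes-below : ∀ {X Y} → (∀ {u w} → u ∈ X → w ∈ Y → level u < level w) → Precedes layout X Y
    precedes-below below u w u∈ w∈ _ = <⇒≤ (rank-levelwise (below u∈ w∈))

    precedes-nearby : ∀ {X Y} → (∀ {u w} → u ∈ X → w ∈ Y → level u < t + level w × level w < t + level u) →
                      (∀ {u w} → u ∈ X → w ∈ Y → level u ≡ level w → rank u ≤ rank w) → Precedes layout X Y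
    precedes-nearby close ordered u w u∈ w∈ same =
      let lu< , lw< = close u∈ w∈ in ordered u∈ w∈ (sameTrack⇒sameLevel same lu< lw<)

-- Paths

Consecutive : ℕ → ℕ → Set
Consecutive p q = suc p ≡ q ⊎ suc q ≡ p

consecutive-≤ : ∀ {p q} → Consecutive p q → q ≤ suc p
consecutive-≤ (inj₁ refl) = ≤-refl
consecutive-≤ (inj₂ refl) = m≤n+m _ 2

consecutive-< : ∀ {p q} → Consecutive p q → p < q → suc p ≡ q
consecutive-< (inj₁ eq) _ = eq
consecutive-< (inj₂ refl) p<q = contradiction p<q (<-asym (n<1+n _))

consecutive-≢ : ∀ {p q} → Consecutive p q → p ≢ q
consecutive-≢ (inj₁ refl) = λ eq → 1+n≢n (sym eq)
consecutive-≢ (inj₂ refl) = 1+n≢n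

m+2≰1+m : ∀ {m} → ¬ (m + 2 ≤ suc m)
m+2≰1+m {m} le = <-irrefl refl (subst (_≤ suc m) (+-comm m 2) le)

module PathLayout (G : Graph) (σ : Fin (n G) → V G) (σ-bij : Bijective _≡_ _≡_ σ)
  (σ-path : ∀ i j → (Edge G (σ i) (σ j) → (suc (toℕ i) ≡ toℕ j ⊎ suc (toℕ j) ≡ toℕ i))
                  × ((suc (toℕ i) ≡ toℕ j ⊎ suc (toℕ j) ≡ toℕ i) → Edge G (σ i) (σ j)))
  (default : Fin (n G)) where

  open Numbering G σ σ-bij default

  edge-consecutive : ∀ {u v} → Edge G u v → Consecutive (pos u) (pos v)
  edge-consecutive {u} {v} e = proj₁ (σ-path (π⁻¹ u) (π⁻¹ v)) (subst₂ (Edge G) (sym (π-π⁻¹ u)) (sym (π-π⁻¹ v)) e)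

  parity : V G → Fin 2
  parity v = pos v mod 2

  parity-indep : ∀ {u v} → Edge G u v → parity u ≢ parity v
  parity-indep {u} {v} e same with <-cmp (pos u) (pos v)
  ... | tri< u<v _ _ = m+2≰1+m (≤-trans (mod-gap 2 same u<v) (consecutive-≤ (edge-consecutive e)))
  ... | tri≈ _ u≡v _ = consecutive-≢ (edge-consecutive e) u≡v
  ... | tri> _ _ v<u = m+2≰1+m (≤-trans (mod-gap 2 (sym same) v<u) (consecutive-≤ (edge-consecutive (edge-sym G e))))

  parity-noX : ∀ {u v x y} → Edge G u v → Edge G x y → parity u ≡ parity x →
               pos u < pos x → pos y < pos v → ⊥
  parity-noX {u} {v} {x} {y} e₁ e₂ same u<x y<v = <-irrefl refl (begin-strict
    pos u + 2    ≤⟨ mod-gap 2 same u<x ⟩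
    pos x        ≤⟨ consecutive-≤ (edge-consecutive (edge-sym G e₂)) ⟩
    suc (pos y)  <⟨ s≤s y<v ⟩
    suc (pos v)  ≤⟨ s≤s (consecutive-≤ (edge-consecutive e₁)) ⟩
    2 + pos u    ≡⟨ +-comm 2 (pos u) ⟩
    pos u + 2    ∎)
    where open ≤-Reasoning

  layout : TrackLayout G 2
  layout = record
    { track    = parity
    ; rank     = pos
    ; rank-inj = λ _ _ _ → pos-injective
    ; indep    = λ _ _ → parity-indep
    ; noX      = λ _ _ _ _ e₁ e₂ same _ _ u<x y<v → parity-noX e₁ e₂ same u<x y<v
    }

  PositionsBefore : Subset (n G) → Subset (n G) → Set
  PositionsBefore X Y = ∀ {u w} → u ∈ X → w ∈ Y → pos u ≤ pos w

  windows : ℕ → ℕ → List (Subset (n G))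
  windows p zero    = []
  windows p (suc k) = atPositions (p ∷ []) ∷ atPositions (p ∷ suc p ∷ []) ∷ windows (suc p) k

  candidates : List (Subset (n G))
  candidates = atPositions [] ∷ windows 0 (n G)

  windows-from : ∀ p k {X u} → X ∈ₗ windows p k → u ∈ X → p ≤ pos u
  windows-from p (suc k) (here refl) u∈ with ∈-atPositions⁻ (p ∷ []) u∈
  ... | here eq = ≤-reflexive (sym eq)
  windows-from p (suc k) (there (here refl)) u∈ with ∈-atPositions⁻ (p ∷ suc p ∷ []) u∈
  ... | here eq         = ≤-reflexive (sym eq)
  ... | there (here eq) = ≤-trans (n≤1+n p) (≤-reflexive (sym eq))
  windows-from p (suc k) (there (there X∈)) u∈ = <⇒≤ (windows-from (suc p) k X∈ u∈)

  windows-before : ∀ p k → AllPairs PositionsBefore (windows p k)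
  windows-before p zero = []
  windows-before p (suc k) =
    (singleBefore (there (here refl)) ∷ All.tabulate λ Y∈ → singleBefore (there (there Y∈)))
    ∷ (All.tabulate λ Y∈ u∈ w∈ → ≤-trans (pairBelow u∈) (windows-from (suc p) k Y∈ w∈))
    ∷ windows-before (suc p) k
    where
    singleBefore : ∀ {Y} → Y ∈ₗ windows p (suc k) → PositionsBefore (atPositions (p ∷ [])) Y
    singleBefore Y∈ u∈ w∈ with ∈-atPositions⁻ (p ∷ []) u∈
    ... | here eq = subst (_≤ _) (sym eq) (windows-from p (suc k) Y∈ w∈)
    pairBelow : ∀ {u} → u ∈ atPositions (p ∷ suc p ∷ []) → pos u ≤ suc p
    pairBelow u∈ with ∈-atPositions⁻ (p ∷ suc p ∷ []) u∈
    ... | here eq         = ≤-trans (≤-reflexive eq) (n≤1+n p)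
    ... | there (here eq) = ≤-reflexive eq

  ∈-windows : ∀ p k {x} → p ≤ x → x < p + k →
              atPositions (x ∷ []) ∈ₗ windows p k × atPositions (x ∷ suc x ∷ []) ∈ₗ windows p k
  ∈-windows p zero p≤x x<p+0 = contradiction (≤-trans x<p+0 (≤-reflexive (+-identityʳ p))) (≤⇒≯ p≤x)
  ∈-windows p (suc k) {x} p≤x x<p+k with p ≟ x
  ... | yes refl = here refl , there (here refl)
  ... | no p≢x   = let single∈ , pair∈ = ∈-windows (suc p) k (≤∧≢⇒< p≤x p≢x) (subst (x <_) (+-suc p k) x<p+k)
                   in there (there single∈) , there (there pair∈)

  position-shapes : ∀ ps → AllPairs _<_ ps → (∀ {p} → p ∈ₗ ps → p < n G) →
                    (∀ {p q} → p ∈ₗ ps → q ∈ₗ ps → p < q → Edge G (at p) (at q)) →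
                    atPositions ps ∈ₗ candidates
  position-shapes [] _ _ _ = here refl
  position-shapes (x ∷ []) _ bound _ = there (proj₁ (∈-windows 0 (n G) z≤n (bound (here refl))))
  position-shapes (x ∷ y ∷ []) ((x<y ∷ []) ∷ _) bound adjacent =
    there (subst (λ z → atPositions (x ∷ z ∷ []) ∈ₗ windows 0 (n G)) (consecutive-< xy x<y)
                 (proj₂ (∈-windows 0 (n G) z≤n (bound (here refl)))))
    where
    xy : Consecutive x y
    xy = subst₂ Consecutive (pos-at (bound (here refl))) (pos-at (bound (there (here refl))))
           (edge-consecutive (adjacent (here refl) (there (here refl)) x<y))
  position-shapes (x ∷ y ∷ z ∷ _) ((x<y ∷ x<z ∷ _) ∷ (y<z ∷ _) ∷ _) bound adjacent =
    ⊥-elim (<⇒≱ (≤-<-trans x<y y<z) (consecutive-≤ xz))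
    where
    xz : Consecutive x z
    xz = subst₂ Consecutive (pos-at (bound (here refl))) (pos-at (bound (there (there (here refl)))))
           (edge-consecutive (adjacent (here refl) (there (there (here refl))) x<z))

  maximal-candidate : ∀ C → IsMaximalClique G C → C ∈ₗ candidates
  maximal-candidate C (clique , _) =
    subst (_∈ₗ candidates) (atPositions-positions C)
      (position-shapes (positions C) (positions-increasing C) (λ p∈ → proj₁ (∈-positions⁻ p∈))
                       (λ p∈ q∈ → clique-at-adjacent clique (∈-positions⁻ p∈) (∈-positions⁻ q∈)))

  colorable : CliqueColorable layout 1
  colorable = cliqueColorable layout 1 (λ _ → Fin.zero) candidates maximal-candidate
    ((All.tabulate λ _ _ _ _ _ _ u∈ _ _ → contradiction (∈-atPositions⁻ [] u∈) λ ())
     ∷ AllPairs.map (λ before _ _ _ u w u∈ w∈ _ → before u∈ w∈) (windows-before 0 (n G)))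

path-layout : (G : Graph) → IsPath G → Σ (TrackLayout G 2) λ L → CliqueColorable L 1
path-layout G (σ , σ-bij , σ-path) with n G ≤? 1
... | yes n≤1 = ≤1-vertex-layout G n≤1
... | no n≰1  = layout , colorable
  where open PathLayout G σ σ-bij σ-path (fromℕ< (≤-trans (s≤s z≤n) (≰⇒> n≰1)))

-- Trees

module _ {P : ℕ → Set} (P? : Decidable P) where

  -- Abstract, so that type checking never unfolds the search (which is very costly).
  abstract
    least-from : ∀ i k → P (i + k) → (∀ j → j < i → ¬ P j) → Σ ℕ λ m → P m × (∀ j → P j → m ≤ j)
    least-from i zero    p below = i , subst P (+-identityʳ i) p , λ j pj → ≮⇒≥ λ j<i → below j j<i pj
    least-from i (suc k) p below with P? i
    ... | yes pi = i , pi , λ j pj → ≮⇒≥ λ j<i → below j j<i pj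
    ... | no ¬pi = least-from (suc i) k (subst P (+-suc i k) p)
                     λ j j<1+i → [ below j , (λ { refl → ¬pi }) ] (m<1+n⇒m<n∨m≡n j<1+i)

    least : ∀ k → P k → Σ ℕ λ m → P m × (∀ j → P j → m ≤ j)
    least k pk = least-from 0 k pk λ _ ()

m∸n≡1+[m∸1+n] : ∀ {m n} → n < m → m ∸ n ≡ suc (m ∸ suc n)
m∸n≡1+[m∸1+n] {suc m} {zero}  _         = refl
m∸n≡1+[m∸1+n] {suc m} {suc n} (s≤s n<m) = m∸n≡1+[m∸1+n] n<m

suc-mod2≢ : ∀ m → m mod 2 ≢ suc m mod 2
suc-mod2≢ m same = <-irrefl refl (≤-trans (≤-reflexive (+-comm 2 m)) (mod-gap 2 same (n<1+n m)))

Fin2-distinct³ : (a b c : Fin 2) → a ≢ b → b ≢ c → a ≢ c → ⊥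
Fin2-distinct³ Fin.zero    Fin.zero    _ a≢b _ _ = a≢b refl
Fin2-distinct³ Fin.zero    (Fin.suc Fin.zero) Fin.zero    _ _ a≢c = a≢c refl
Fin2-distinct³ Fin.zero    (Fin.suc Fin.zero) (Fin.suc Fin.zero) _ b≢c _ = b≢c refl
Fin2-distinct³ (Fin.suc Fin.zero) (Fin.suc Fin.zero) _ a≢b _ _ = a≢b refl
Fin2-distinct³ (Fin.suc Fin.zero) Fin.zero    Fin.zero    _ b≢c _ = b≢c refl
Fin2-distinct³ (Fin.suc Fin.zero) Fin.zero    (Fin.suc Fin.zero) _ _ a≢c = a≢c refl

walkLength : ∀ {G : Graph} {u v} → Walk G u v → ℕ
walkLength here       = 0
walkLength (step _ p) = suc (walkLength p)

cycle : ∀ {G : Graph} K → 3 ≤ K → (g : ℕ → V G) → (∀ {s t} → s < K → t < K → g s ≡ g t → s ≡ t) →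
        (∀ {t} → suc t < K → Edge G (g t) (g (suc t))) → Edge G (g (K ∸ 1)) (g 0) → HasCycle G
cycle (suc zero)       (s≤s ())
cycle (suc (suc zero)) (s≤s (s≤s ()))
cycle {G} (suc (suc (suc k))) _ g g-injective g-edge closing = k , f , f-injective , f-edge , f-closing
  where
  f : Fin (3 + k) → V G
  f i = g (toℕ i)
  f-injective : ∀ {i j} → f i ≡ f j → i ≡ j
  f-injective {i} {j} eq = Finₚ.toℕ-injective (g-injective (Finₚ.toℕ<n i) (Finₚ.toℕ<n j) eq)
  f-edge : ∀ (i : Fin (2 + k)) → Edge G (f (inject₁ i)) (f (Fin.suc i))
  f-edge i = subst (λ s → Edge G (g s) (g (suc (toℕ i)))) (sym (Finₚ.toℕ-inject₁ i)) (g-edge (s≤s (Finₚ.toℕ<n i)))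
  f-closing : Edge G (f (fromℕ (2 + k))) (f Fin.zero)
  f-closing = subst (λ s → Edge G (g s) (g 0)) (sym (Finₚ.toℕ-fromℕ (2 + k))) closing

module TreeLayout (G : Graph) (connected : Connected G) (acyclic : ¬ HasCycle G)
                  (root other : V G) (root≢other : root ≢ other) where

  Within : ℕ → V G → Set
  Within zero    v = v ≡ root
  Within (suc k) v = Within k v ⊎ Σ (V G) λ w → Within k w × Edge G w v

  within? : ∀ k v → Dec (Within k v)
  within? zero    v = v Fin.≟ root
  within? (suc k) v = within? k v ⊎-dec Finₚ.any? λ w → within? k w ×-dec (adj G w v Bool.≟ true)

  within-walk : ∀ {k u v} → Within k u → (p : Walk G u v) → Within (k + walkLength p) v
  within-walk {k} {u} w-u here           = subst (λ i → Within i u) (sym (+-identityʳ k)) w-u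
  within-walk {k} {u} {v} w-u (step e p) =
    subst (λ i → Within i v) (sym (+-suc k (walkLength p))) (within-walk (inj₂ (u , w-u , e)) p)

  private
    distance : ∀ v → Σ ℕ λ m → Within m v × (∀ j → Within j v → m ≤ j)
    distance v = least (λ k → within? k v) _ (within-walk refl (connected root v))

  depth : V G → ℕ
  depth v = proj₁ (distance v)

  within-depth : ∀ v → Within (depth v) v
  within-depth v = proj₁ (proj₂ (distance v))

  depth-least : ∀ {k v} → Within k v → depth v ≤ k
  depth-least {k} {v} w = proj₂ (proj₂ (distance v)) k w

  depth-edge : ∀ {u v} → Edge G u v → depth v ≤ suc (depth u)
  depth-edge {u} e = depth-least (inj₂ (u , within-depth u , e))

  depth-root : depth root ≡ 0
  depth-root = n≤0⇒n≡0 (depth-least refl)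

  depth≡0⇒root : ∀ {v} → depth v ≡ 0 → v ≡ root
  depth≡0⇒root {v} eq = subst (λ k → Within k v) eq (within-depth v)

  depth≡suc : ∀ {v k} → depth v ≡ suc k → Σ (V G) λ w → Edge G w v × depth w ≡ k
  depth≡suc {v} {k} eq with subst (λ i → Within i v) eq (within-depth v)
  ... | inj₁ within-k = contradiction (subst (_≤ k) eq (depth-least within-k)) (<-irrefl refl)
  ... | inj₂ (w , within-w , e) =
    w , e , ≤-antisym (depth-least within-w) (≤-pred (subst (_≤ suc (depth w)) eq (depth-edge e)))

  IsParent : V G → V G → Set
  IsParent w v = Edge G w v × suc (depth w) ≡ depth v

  parent? : ∀ v → Dec (Σ (V G) λ w → IsParent w v)
  parent? v = Finₚ.any? λ w → (adj G w v Bool.≟ true) ×-dec (suc (depth w) ≟ depth v)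

  -- Abstract for the same reason as least.
  abstract
    parent : V G → V G
    parent v with parent? v
    ... | yes (w , _) = w
    ... | no _        = root

    parent-isParent : ∀ {v} → v ≢ root → IsParent (parent v) v
    parent-isParent {v} v≢root with parent? v
    ... | yes (_ , isParent) = isParent
    ... | no noParent with depth v in eq
    ...   | zero  = contradiction (depth≡0⇒root eq) v≢root
    ...   | suc k = let w , e , dw = depth≡suc eq in contradiction (w , e , cong suc dw) noParent

    parent-root : parent root ≡ root
    parent-root with parent? root
    ... | yes (_ , _ , d≡) = contradiction (trans d≡ depth-root) λ ()
    ... | no _             = refl

  depth-parent : ∀ v → depth (parent v) ≡ depth v ∸ 1
  depth-parent v with v Fin.≟ root
  ... | yes refl   = trans (cong depth parent-root) (trans depth-root (cong (_∸ 1) (sym depth-root)))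
  ... | no v≢root = cong (_∸ 1) (proj₂ (parent-isParent v≢root))

  ancestor : ℕ → V G → V G
  ancestor zero    v = v
  ancestor (suc i) v = parent (ancestor i v)

  depth-ancestor : ∀ i v → depth (ancestor i v) ≡ depth v ∸ i
  depth-ancestor zero    v = refl
  depth-ancestor (suc i) v = begin
    depth (parent (ancestor i v))  ≡⟨ depth-parent (ancestor i v) ⟩
    depth (ancestor i v) ∸ 1       ≡⟨ cong (_∸ 1) (depth-ancestor i v) ⟩
    depth v ∸ i ∸ 1                ≡⟨ ∸-+-assoc (depth v) i 1 ⟩
    depth v ∸ (i + 1)              ≡⟨ cong (depth v ∸_) (+-comm i 1) ⟩
    depth v ∸ suc i                ∎
    where open ≡-Reasoning

  ancestor-depth : ∀ v → ancestor (depth v) v ≡ root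
  ancestor-depth v = depth≡0⇒root (trans (depth-ancestor (depth v) v) (n∸n≡0 (depth v)))

  ancestor-edge : ∀ {i v} → i < depth v → Edge G (ancestor (suc i) v) (ancestor i v)
  ancestor-edge {i} {v} i<d = proj₁ (parent-isParent not-root)
    where
    not-root : ancestor i v ≢ root
    not-root eq = <⇒≱ i<d (m∸n≡0⇒m≤n (trans (sym (depth-ancestor i v)) (trans (cong depth eq) depth-root)))

  ancestor-injective : ∀ {s t v} → s ≤ depth v → t ≤ depth v → ancestor s v ≡ ancestor t v → s ≡ t
  ancestor-injective {s} {t} {v} s≤d t≤d eq =
    ∸-cancelˡ-≡ s≤d t≤d (trans (sym (depth-ancestor s v)) (trans (cong depth eq) (depth-ancestor t v)))

  -- The ancestor paths of x and y up to their first common ancestor form an arc from x to y;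
  -- an edge x y, or a common child of x and y, would close it into a cycle.
  module Meet {x y} (x≢y : x ≢ y) (same : depth x ≡ depth y) where

    private
      meet-at-depth : ancestor (depth x) x ≡ ancestor (depth x) y
      meet-at-depth = trans (ancestor-depth x) (sym (subst (λ k → ancestor k y ≡ root) (sym same) (ancestor-depth y)))

      meeting : Σ ℕ λ m → ancestor m x ≡ ancestor m y × (∀ i → ancestor i x ≡ ancestor i y → m ≤ i)
      meeting = least (λ i → ancestor i x Fin.≟ ancestor i y) (depth x) meet-at-depth

    j : ℕ
    j = proj₁ meeting

    j-meets : ancestor j x ≡ ancestor j y
    j-meets = proj₁ (proj₂ meeting)

    j-least : ∀ {i} → ancestor i x ≡ ancestor i y → j ≤ i
    j-least = proj₂ (proj₂ meeting) _

    j≤dx : j ≤ depth x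
    j≤dx = j-least meet-at-depth

    j≤dy : j ≤ depth y
    j≤dy = subst (j ≤_) same j≤dx

    1≤j : 1 ≤ j
    1≤j with j in j≡
    ... | zero  = contradiction (subst (λ i → ancestor i x ≡ ancestor i y) j≡ j-meets) x≢y
    ... | suc _ = s≤s z≤n

    J : ℕ
    J = j + j

    arc : ℕ → V G
    arc t with t ≤? j
    ... | yes _ = ancestor t x
    ... | no _  = ancestor (J ∸ t) y

    arc-x : ∀ {t} → t ≤ j → arc t ≡ ancestor t x
    arc-x {t} t≤j with t ≤? j
    ... | yes _   = refl
    ... | no t≰j = contradiction t≤j t≰j

    arc-y : ∀ {t} → j ≤ t → arc t ≡ ancestor (J ∸ t) y
    arc-y {t} j≤t with t ≤? j
    ... | no _    = refl
    ... | yes t≤j with ≤-antisym t≤j j≤t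
    ...   | refl = trans j-meets (cong (λ i → ancestor i y) (sym (m+n∸n≡m j j)))

    arc-start : arc 0 ≡ x
    arc-start = arc-x z≤n

    arc-end : arc J ≡ y
    arc-end = trans (arc-y (m≤m+n j j)) (cong (λ i → ancestor i y) (n∸n≡0 J))

    mirror< : ∀ {t} → j < t → t ≤ J → J ∸ t < j
    mirror< {t} j<t t≤J = +-cancelʳ-< t (J ∸ t) j (subst (_< j + t) (sym (m∸n+n≡m t≤J)) (+-monoʳ-< j j<t))

    sides-disjoint : ∀ {s u} → s ≤ j → u < j → ancestor s x ≢ ancestor u y
    sides-disjoint {s} {u} s≤j u<j eq = <⇒≱ u<j (j-least (subst (λ i → ancestor i x ≡ ancestor u y) s≡u eq))
      where
      s≡u : s ≡ u
      s≡u = ∸-cancelˡ-≡ (≤-trans s≤j j≤dx) (≤-trans (<⇒≤ u<j) j≤dx)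
              (trans (sym (depth-ancestor s x)) (trans (cong depth eq) (trans (depth-ancestor u y) (cong (_∸ u) (sym same)))))

    arc-injective : ∀ {s t} → s ≤ J → t ≤ J → arc s ≡ arc t → s ≡ t
    arc-injective {s} {t} s≤J t≤J eq = sides (≤-<-connex s j) (≤-<-connex t j)
      where
      sides : s ≤ j ⊎ j < s → t ≤ j ⊎ j < t → s ≡ t
      sides (inj₁ s≤j) (inj₁ t≤j) = ancestor-injective (≤-trans s≤j j≤dx) (≤-trans t≤j j≤dx)
                                      (trans (sym (arc-x s≤j)) (trans eq (arc-x t≤j)))
      sides (inj₁ s≤j) (inj₂ j<t) = contradiction (trans (sym (arc-x s≤j)) (trans eq (arc-y (<⇒≤ j<t))))
                                      (sides-disjoint s≤j (mirror< j<t t≤J))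
      sides (inj₂ j<s) (inj₁ t≤j) = contradiction (trans (sym (arc-x t≤j)) (trans (sym eq) (arc-y (<⇒≤ j<s))))
                                      (sides-disjoint t≤j (mirror< j<s s≤J))
      sides (inj₂ j<s) (inj₂ j<t) = ∸-cancelˡ-≡ s≤J t≤J
        (ancestor-injective (≤-trans (<⇒≤ (mirror< j<s s≤J)) j≤dy) (≤-trans (<⇒≤ (mirror< j<t t≤J)) j≤dy)
                            (trans (sym (arc-y (<⇒≤ j<s))) (trans eq (arc-y (<⇒≤ j<t)))))

    arc-edge : ∀ {t} → suc t ≤ J → Edge G (arc t) (arc (suc t))
    arc-edge {t} t<J = [ x-side , y-side ]′ (≤-<-connex (suc t) j)
      where
      x-side : suc t ≤ j → Edge G (arc t) (arc (suc t))
      x-side t<j = subst₂ (Edge G) (sym (arc-x (<⇒≤ t<j))) (sym (arc-x t<j))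
                     (edge-sym G (ancestor-edge (<-≤-trans t<j j≤dx)))
      y-side : j < suc t → Edge G (arc t) (arc (suc t))
      y-side j<1+t = subst₂ (Edge G)
                       (sym (trans (arc-y (≤-pred j<1+t)) (cong (λ i → ancestor i y) (m∸n≡1+[m∸1+n] t<J))))
                       (sym (arc-y (<⇒≤ j<1+t)))
                       (ancestor-edge (<-≤-trans (mirror< j<1+t t<J) j≤dy))

    arc-depth : ∀ t → depth (arc t) ≤ depth x
    arc-depth t = [ x-side , y-side ]′ (≤-<-connex t j)
      where
      x-side : t ≤ j → depth (arc t) ≤ depth x
      x-side t≤j = ≤-trans (≤-reflexive (trans (cong depth (arc-x t≤j)) (depth-ancestor t x))) (m∸n≤m (depth x) t)
      y-side : j < t → depth (arc t) ≤ depth x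
      y-side j<t = ≤-trans (≤-reflexive (trans (cong depth (arc-y (<⇒≤ j<t))) (depth-ancestor (J ∸ t) y)))
                           (≤-trans (m∸n≤m (depth y) (J ∸ t)) (≤-reflexive (sym same)))

    not-adjacent : ¬ Edge G x y
    not-adjacent e = acyclic (cycle {G} (suc J) (s≤s (+-mono-≤ 1≤j 1≤j)) arc
      (λ s<K t<K → arc-injective (≤-pred s<K) (≤-pred t<K)) (λ t<K → arc-edge (≤-pred t<K))
      (subst₂ (Edge G) (sym arc-end) (sym arc-start) (edge-sym G e)))

    no-common-child : ∀ {v} → Edge G x v → Edge G y v → depth v ≡ suc (depth x) → ⊥
    no-common-child {v} x-v y-v deeper =
      acyclic (cycle {G} (suc (suc J)) (s≤s (s≤s (≤-trans (s≤s z≤n) (+-mono-≤ 1≤j 1≤j)))) loop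
                 loop-injective loop-edge (subst (λ w → Edge G w v) (sym arc-end) y-v))
      where
      loop : ℕ → V G
      loop zero    = v
      loop (suc t) = arc t
      v∉arc : ∀ t → v ≢ arc t
      v∉arc t eq = <-irrefl refl (≤-trans (≤-reflexive (sym deeper)) (subst (λ w → depth w ≤ depth x) (sym eq) (arc-depth t)))
      loop-injective : ∀ {s t} → s < suc (suc J) → t < suc (suc J) → loop s ≡ loop t → s ≡ t
      loop-injective {zero}  {zero}  _ _ _  = refl
      loop-injective {zero}  {suc t} _ _ eq = contradiction eq (v∉arc t)
      loop-injective {suc s} {zero}  _ _ eq = contradiction (sym eq) (v∉arc s)
      loop-injective {suc s} {suc t} (s≤s (s≤s s≤J)) (s≤s (s≤s t≤J)) eq = cong suc (arc-injective s≤J t≤J eq)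
      loop-edge : ∀ {t} → suc t < suc (suc J) → Edge G (loop t) (loop (suc t))
      loop-edge {zero}  _                = subst (Edge G v) (sym arc-start) (edge-sym G x-v)
      loop-edge {suc t} (s≤s (s≤s t<J)) = arc-edge t<J

  edge-depth≢ : ∀ {u v} → Edge G u v → depth u ≢ depth v
  edge-depth≢ e same = Meet.not-adjacent (λ { refl → edge-irrefl G e }) same e

  non-root : ∀ {u v} → suc (depth u) ≡ depth v → v ≢ root
  non-root d≡ refl = contradiction (trans d≡ depth-root) λ ()

  deeper-neighbour-parent : ∀ {w v} → Edge G w v → suc (depth w) ≡ depth v → w ≡ parent v
  deeper-neighbour-parent {w} {v} e d≡ with w Fin.≟ parent v
  ... | yes w≡p = w≡p
  ... | no w≢p  = ⊥-elim (Meet.no-common-child w≢p same e p-v (sym d≡))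
    where
    p-v = proj₁ (parent-isParent (non-root d≡))
    same : depth w ≡ depth (parent v)
    same = suc-injective (trans d≡ (sym (proj₂ (parent-isParent (non-root d≡)))))

  ParentOf : V G → V G → Set
  ParentOf u v = u ≡ parent v × suc (depth u) ≡ depth v

  edge-parent : ∀ {u v} → Edge G u v → ParentOf u v ⊎ ParentOf v u
  edge-parent {u} {v} e with <-cmp (depth u) (depth v)
  ... | tri< du<dv _ _ = let d≡ = ≤-antisym du<dv (depth-edge e) in inj₁ (deeper-neighbour-parent e d≡ , d≡)
  ... | tri≈ _ du≡dv _ = contradiction du≡dv (edge-depth≢ e)
  ... | tri> _ _ dv<du = let d≡ = ≤-antisym dv<du (depth-edge (edge-sym G e))
                         in inj₂ (deeper-neighbour-parent (edge-sym G e) d≡ , d≡)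

  edge-parity≢ : ∀ {u v} → Edge G u v → depth u mod 2 ≢ depth v mod 2
  edge-parity≢ {u} {v} e with edge-parent e
  ... | inj₁ (_ , d≡) = subst (λ d → depth u mod 2 ≢ d mod 2) d≡ (suc-mod2≢ (depth u))
  ... | inj₂ (_ , d≡) = λ same → subst (λ d → depth v mod 2 ≢ d mod 2) d≡ (suc-mod2≢ (depth v)) (sym same)

  M : ℕ
  M = n G

  2≤M : 2 ≤ M
  2≤M = ≰⇒> λ M≤1 → root≢other (Fin≤1-irrelevant M≤1 root other)

  -- key v is the base-M numeral 1 a₀ … a_d whose digits a₀ = root, …, a_d = v are the path down
  -- to v; the leading 1 fixes the number of digits, and so the size, by the depth.
  prefixAt : ℕ → V G → ℕ
  prefixAt zero    v = 1
  prefixAt (suc d) v = prefixAt d (parent v) * M + toℕ (parent v)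

  key : V G → ℕ
  key v = prefixAt (depth v) v * M + toℕ v

  key-parent : ∀ {u v} → ParentOf u v → key v ≡ key u * M + toℕ v
  key-parent {v = v} (refl , d≡) = cong (λ d → prefixAt d v * M + toℕ v) (sym d≡)

  key-injective : ∀ {u v} → key u ≡ key v → u ≡ v
  key-injective {u} {v} eq = Finₚ.toℕ-injective (proj₂ (lex-injective M {prefixAt (depth u) u} {prefixAt (depth v) v}
                                                (Finₚ.toℕ<n u) (Finₚ.toℕ<n v) eq))

  digit-bounds : ∀ {d a p} → M ^ d ≤ a → a < M ^ suc d → p < M →
                 M ^ suc d ≤ a * M + p × a * M + p < M ^ suc (suc d)
  digit-bounds {d} {a} {p} lo hi p<M =
    ≤-trans (≤-trans (≤-reflexive (*-comm M (M ^ d))) (*-monoˡ-≤ M lo)) (m≤m+n (a * M) p) ,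
    <-≤-trans (lex-< M {q = 0} hi p<M)
              (≤-reflexive (trans (+-identityʳ _) (*-comm (M ^ suc d) M)))

  prefix-bounds : ∀ d v → M ^ d ≤ prefixAt d v × prefixAt d v < M ^ suc d
  prefix-bounds zero    v = ≤-refl , ≤-trans 2≤M (≤-reflexive (sym (*-identityʳ M)))
  prefix-bounds (suc d) v = let lo , hi = prefix-bounds d (parent v) in digit-bounds {d} lo hi (Finₚ.toℕ<n (parent v))

  key-bounds : ∀ v → M ^ suc (depth v) ≤ key v × key v < M ^ suc (suc (depth v))
  key-bounds v = let lo , hi = prefix-bounds (depth v) v in digit-bounds {depth v} lo hi (Finₚ.toℕ<n v)

  key-levelwise : ∀ {u v} → depth u < depth v → key u < key v
  key-levelwise {u} {v} du<dv =
    <-≤-trans (proj₂ (key-bounds u))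
      (≤-trans (^-monoʳ-≤ M {{>-nonZero (≤-trans (s≤s z≤n) 2≤M)}} (s≤s du<dv)) (proj₁ (key-bounds v)))

  open Levelled G 3 1 (s≤s (s≤s (s≤s z≤n))) depth key key-injective key-levelwise edge-depth≢ depth-edge

  children-ordered : ∀ {u v x y} → ParentOf u v → ParentOf x y → key u < key x → key v < key y
  children-ordered {v = v} pu px ku<kx =
    subst₂ _<_ (sym (key-parent pu)) (sym (key-parent px)) (lex-< M ku<kx (Finₚ.toℕ<n v))

  crossingFree : SameLevelCrossingFree
  crossingFree {u} {v} e₁ e₂ ux vy ku<kx ky<kv with edge-parent e₁ | edge-parent e₂
  ... | inj₁ pu | inj₁ px = <-asym ky<kv (children-ordered pu px ku<kx)
  ... | inj₂ pv | inj₂ py = <-asym ku<kx (children-ordered py pv ky<kv)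
  ... | inj₁ (_ , d₁) | inj₂ (_ , d₂) =
    <-irrefl (trans (sym d₁) (cong suc (trans ux (trans (sym d₂) (cong suc (sym vy))))))
             (≤-trans (n<1+n (depth v)) (n≤1+n _))
  ... | inj₂ (_ , d₁) | inj₁ (_ , d₂) =
    <-irrefl (trans (sym d₁) (cong suc (trans vy (trans (sym d₂) (cong suc (sym ux))))))
             (≤-trans (n<1+n (depth u)) (n≤1+n _))

  L : TrackLayout G 3
  L = layout crossingFree

  open Numbering G id (Identity.bijective _≡_) root

  parentEdge : V G → Subset (n G)
  parentEdge v = atPositions (toℕ (parent v) ∷ toℕ v ∷ [])

  ∈-parentEdge⁻ : ∀ {u v} → u ∈ parentEdge v → u ≡ parent v ⊎ u ≡ v
  ∈-parentEdge⁻ {v = v} u∈ with ∈-atPositions⁻ (toℕ (parent v) ∷ toℕ v ∷ []) u∈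
  ... | here eq         = inj₁ (Finₚ.toℕ-injective eq)
  ... | there (here eq) = inj₂ (Finₚ.toℕ-injective eq)

  child∈parentEdge : ∀ v → v ∈ parentEdge v
  child∈parentEdge v = ∈-atPositions⁺ {ps = toℕ (parent v) ∷ toℕ v ∷ []} (there (here refl))

  parentEdge-depths : ∀ {u v} → v ≢ root → u ∈ parentEdge v → depth u ≤ depth v × depth v ≤ suc (depth u)
  parentEdge-depths {v = v} v≢root u∈ with ∈-parentEdge⁻ u∈
  ... | inj₁ refl = let d≡ = proj₂ (parent-isParent v≢root) in
                    ≤-trans (n≤1+n _) (≤-reflexive d≡) , ≤-reflexive (sym d≡)
  ... | inj₂ refl = ≤-refl , n≤1+n _

  maxDepth : Subset (n G) → ℕ
  maxDepth X = max 0 (map (λ p → depth (at p)) (positions X))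

  maxDepth-parentEdge : ∀ {v} → v ≢ root → maxDepth (parentEdge v) ≡ depth v
  maxDepth-parentEdge {v} v≢root = max≈v⁺ attained bounded z≤n
    where
    attained : depth v ∈ₗ map (λ p → depth (at p)) (positions (parentEdge v))
    attained = subst (_∈ₗ map (λ p → depth (at p)) (positions (parentEdge v))) (cong depth (at-pos v))
                 (∈-map⁺ (λ p → depth (at p)) (∈-positions⁺ {parentEdge v} (child∈parentEdge v)))
    bounded : All (_≤ depth v) (map (λ p → depth (at p)) (positions (parentEdge v)))
    bounded = Allₚ.map⁺ (All.tabulate λ p∈ → proj₁ (parentEdge-depths v≢root (proj₂ (∈-positions⁻ p∈))))

  class : Subset (n G) → Fin 2
  class X = maxDepth X mod 2

  neighbour : ∀ w → Σ (V G) (Edge G w)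
  neighbour w with w Fin.≟ root
  ... | no w≢root = parent w , edge-sym G (proj₁ (parent-isParent w≢root))
  ... | yes refl  = first-step (connected root other) root≢other
    where
    first-step : ∀ {v} → Walk G root v → root ≢ v → Σ (V G) (Edge G root)
    first-step here       root≢root = contradiction refl root≢root
    first-step (step e _) _         = _ , e

  at-most-one-not-maximal : ∀ {C w} → (∀ {u} → u ∈ C → u ≡ w) → ¬ IsMaximalClique G C
  at-most-one-not-maximal {C} {w} only-w (_ , maximal) =
    let u , u∈ , ¬u-z = maximal z z∉C in ¬u-z (subst (λ u → Edge G u z) (sym (only-w u∈)) w-z)
    where
    z = proj₁ (neighbour w)
    w-z = proj₂ (neighbour w)
    z∉C : z ∉ C
    z∉C z∈ = edge-irrefl G (subst (Edge G w) (only-w z∈) w-z)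

  maximal-parentEdge⇒non-root : ∀ {v} → IsMaximalClique G (parentEdge v) → v ≢ root
  maximal-parentEdge⇒non-root maximal refl =
    at-most-one-not-maximal (λ u∈ → [ (λ eq → trans eq parent-root) , id ] (∈-parentEdge⁻ u∈)) maximal

  maximal-parentEdge : ∀ C → IsMaximalClique G C → Σ (V G) λ v → C ≡ parentEdge v
  maximal-parentEdge C maxC@(clique , _)
    with positions C | positions-increasing C | ∈-positions⁺ {C} | ∈-positions⁻ {C} | atPositions-positions C
  ... | [] | _ | members | _ | _ =
    ⊥-elim (at-most-one-not-maximal {w = root} (λ u∈ → contradiction (members u∈) ¬Any[]) maxC)
  ... | x ∷ [] | _ | members | _ | _ = ⊥-elim (at-most-one-not-maximal only maxC)
    where
    only : ∀ {u} → u ∈ C → u ≡ at x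
    only {u} u∈ with members u∈
    ... | here pos≡x = trans (sym (at-pos u)) (cong at pos≡x)
  ... | x ∷ y ∷ [] | (x<y ∷ []) ∷ _ | _ | ∈C | C≡
    with edge-parent (clique-at-adjacent clique (∈C (here refl)) (∈C (there (here refl))) x<y)
  ...   | inj₁ (x-parent , _) = at y , trans (sym C≡) (cong₂ (λ p q → atPositions (p ∷ q ∷ [])) x≡ y≡)
    where
    x≡ = trans (sym (pos-at (proj₁ (∈C (here refl))))) (cong toℕ x-parent)
    y≡ = sym (pos-at (proj₁ (∈C (there (here refl)))))
  ...   | inj₂ (y-parent , _) = at x , trans (sym C≡) (trans (atPositions-swap x y)
                                  (cong₂ (λ p q → atPositions (p ∷ q ∷ [])) y≡ x≡))
    where
    y≡ = trans (sym (pos-at (proj₁ (∈C (there (here refl)))))) (cong toℕ y-parent)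
    x≡ = sym (pos-at (proj₁ (∈C (here refl))))
  maximal-parentEdge C maxC@(clique , _)
    | x ∷ y ∷ z ∷ _ | (x<y ∷ x<z ∷ _) ∷ (y<z ∷ _) ∷ _ | _ | ∈C | _ =
    ⊥-elim (Fin2-distinct³ _ _ _ (edge-parity≢ (adjacent (here refl) (there (here refl)) x<y))
                                 (edge-parity≢ (adjacent (there (here refl)) (there (there (here refl))) y<z))
                                 (edge-parity≢ (adjacent (here refl) (there (there (here refl))) x<z)))
    where
    adjacent = λ {p} {q} p∈ q∈ → clique-at-adjacent {C} {p} {q} clique (∈C p∈) (∈C q∈)

  parentEdges-precede : ∀ {v w} → v ≢ root → w ≢ root → depth v mod 2 ≡ depth w mod 2 → key v < key w →
                        Precedes L (parentEdge v) (parentEdge w)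
  parentEdges-precede {v} {w} v≢root w≢root same-parity kv<kw with <-cmp (depth v) (depth w)
  ... | tri> _ _ dw<dv = contradiction kv<kw (<-asym (key-levelwise dw<dv))
  ... | tri< dv<dw _ _ = precedes-below crossingFree below
    where
    below : ∀ {u u′} → u ∈ parentEdge v → u′ ∈ parentEdge w → depth u < depth u′
    below u∈ u′∈ = ≤-pred (begin
      suc (suc (depth _))  ≤⟨ s≤s (s≤s (proj₁ (parentEdge-depths v≢root u∈))) ⟩
      2 + depth v          ≡⟨ +-comm 2 (depth v) ⟩
      depth v + 2          ≤⟨ mod-gap 2 same-parity dv<dw ⟩
      depth w              ≤⟨ proj₂ (parentEdge-depths w≢root u′∈) ⟩
      suc (depth _)        ∎)
      where open ≤-Reasoning
  ... | tri≈ _ dv≡dw _ = precedes-nearby crossingFree close ordered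
    where
    close : ∀ {u u′} → u ∈ parentEdge v → u′ ∈ parentEdge w → depth u < 3 + depth u′ × depth u′ < 3 + depth u
    close u∈ u′∈ =
      let u≤v , v≤1+u = parentEdge-depths v≢root u∈ ; u′≤w , w≤1+u′ = parentEdge-depths w≢root u′∈ in
      s≤s (≤-trans u≤v (≤-trans (≤-reflexive dv≡dw) (≤-trans w≤1+u′ (n≤1+n _)))) ,
      s≤s (≤-trans u′≤w (≤-trans (≤-reflexive (sym dv≡dw)) (≤-trans v≤1+u (n≤1+n _))))
    ordered : ∀ {u u′} → u ∈ parentEdge v → u′ ∈ parentEdge w → depth u ≡ depth u′ → key u ≤ key u′
    ordered u∈ u′∈ du≡du′ with ∈-parentEdge⁻ u∈ | ∈-parentEdge⁻ u′∈
    ... | inj₂ refl | inj₂ refl = <⇒≤ kv<kw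
    ... | inj₁ refl | inj₁ refl =
      lex-≤ M (subst₂ _<_ (key-parent (refl , proj₂ (parent-isParent v≢root)))
                          (key-parent (refl , proj₂ (parent-isParent w≢root))) kv<kw) (Finₚ.toℕ<n w)
    ... | inj₁ refl | inj₂ refl =
      contradiction (trans (proj₂ (parent-isParent v≢root)) dv≡dw) (λ eq → <-irrefl (sym eq) (subst (_< _) du≡du′ (n<1+n _)))
    ... | inj₂ refl | inj₁ refl =
      contradiction (trans (proj₂ (parent-isParent w≢root)) (sym dv≡dw)) (λ eq → <-irrefl (sym eq) (subst (_< _) (sym du≡du′) (n<1+n _)))

  open BucketSort key

  candidates : List (Subset (n G))
  candidates = map parentEdge (bucketSort (allFin (n G)))

  candidates-ordered : AllPairs (SameClassPrecedes L class) candidates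
  candidates-ordered = AllPairsₚ.map⁺ (bucketSort-AllPairs (AllPairsₚ.tabulate⁺ {f = id} λ _ → sameKey) lowerKey)
    where
    sameKey : ∀ {v w} → key v ≡ key w → SameClassPrecedes L class (parentEdge v) (parentEdge w)
    sameKey {v} kv≡kw maxV _ _ =
      subst (λ w → Precedes L (parentEdge v) (parentEdge w)) (key-injective kv≡kw) (clique-precedes-itself L (proj₁ maxV))
    lowerKey : ∀ {v w} → key v < key w → SameClassPrecedes L class (parentEdge v) (parentEdge w)
    lowerKey kv<kw maxV maxW same-class =
      let v≢root = maximal-parentEdge⇒non-root maxV ; w≢root = maximal-parentEdge⇒non-root maxW in
      parentEdges-precede v≢root w≢root
        (subst₂ (λ a b → a mod 2 ≡ b mod 2) (maxDepth-parentEdge v≢root) (maxDepth-parentEdge w≢root) same-class) kv<kw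

  colorable : CliqueColorable L 2
  colorable = cliqueColorable L 2 class candidates complete candidates-ordered
    where
    complete : ∀ C → IsMaximalClique G C → C ∈ₗ candidates
    complete C maxC = let v , C≡ = maximal-parentEdge C maxC in
      subst (_∈ₗ candidates) (sym C≡) (∈-map⁺ parentEdge (∈-bucketSort⁺ (∈-allFin v)))

tree-layout : (G : Graph) → IsTree G → Σ (TrackLayout G 3) λ L → CliqueColorable L 2
tree-layout G (connected , acyclic) with n G ≤? 1
... | yes n≤1 = ≤1-vertex-layout G n≤1
... | no n≰1  = L , colorable
  where
  1<n : 1 < n G
  1<n = ≰⇒> n≰1
  open TreeLayout G connected acyclic (fromℕ< (<-trans (s≤s z≤n) 1<n)) (fromℕ< 1<n)
                  (λ eq → 0≢1+n (trans (sym (Finₚ.toℕ-fromℕ< _)) (trans (cong toℕ eq) (Finₚ.toℕ-fromℕ< 1<n))))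

-- Outerplanar graphs

-- The ways the levels of the corners a, b and the apex c of a node sit above its base level m:
-- a or b is on the base level, and c is on the top (+2) or middle (+1) level of the window.
data Shape : Set where
  aLow-cTop aLow-cMid bLow-cTop bLow-cMid : Shape

δa δb δc : Shape → ℕ
δa aLow-cTop = 0
δa aLow-cMid = 0
δa bLow-cTop = 1
δa bLow-cMid = 2
δb aLow-cTop = 1
δb aLow-cMid = 2
δb bLow-cTop = 0
δb bLow-cMid = 0
δc aLow-cTop = 2
δc aLow-cMid = 1
δc bLow-cTop = 2
δc bLow-cMid = 1

-- The children of a node (a, b) with apex c are (a, c) and (c, b); their base levels are the
-- parent's raised by these shifts, and their shapes are given by leftShape and rightShape.
leftShift rightShift : Shape → ℕ
leftShift aLow-cTop = 0
leftShift aLow-cMid = 0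
leftShift bLow-cTop = 1
leftShift bLow-cMid = 1
rightShift τ = 1 ∸ leftShift τ

leftShape rightShape : Shape → Shape
leftShape aLow-cTop = aLow-cMid
leftShape aLow-cMid = aLow-cTop
leftShape bLow-cTop = aLow-cTop
leftShape bLow-cMid = bLow-cTop
rightShape aLow-cTop = bLow-cTop
rightShape aLow-cMid = aLow-cTop
rightShape bLow-cTop = bLow-cMid
rightShape bLow-cMid = bLow-cTop

left-a : ∀ τ → δa (leftShape τ) + leftShift τ ≡ δa τ
left-a aLow-cTop = refl
left-a aLow-cMid = refl
left-a bLow-cTop = refl
left-a bLow-cMid = refl

left-b : ∀ τ → δb (leftShape τ) + leftShift τ ≡ δc τ
left-b aLow-cTop = refl
left-b aLow-cMid = refl
left-b bLow-cTop = refl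
left-b bLow-cMid = refl

right-a : ∀ τ → δa (rightShape τ) + rightShift τ ≡ δc τ
right-a aLow-cTop = refl
right-a aLow-cMid = refl
right-a bLow-cTop = refl
right-a bLow-cMid = refl

right-b : ∀ τ → δb (rightShape τ) + rightShift τ ≡ δb τ
right-b aLow-cTop = refl
right-b aLow-cMid = refl
right-b bLow-cTop = refl
right-b bLow-cMid = refl

δa⊎δb≡0 : ∀ τ → δa τ ≡ 0 ⊎ δb τ ≡ 0
δa⊎δb≡0 aLow-cTop = inj₁ refl
δa⊎δb≡0 aLow-cMid = inj₁ refl
δa⊎δb≡0 bLow-cTop = inj₂ refl
δa⊎δb≡0 bLow-cMid = inj₂ refl

δa≤2 : ∀ τ → δa τ ≤ 2
δa≤2 aLow-cTop = z≤n
δa≤2 aLow-cMid = z≤n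
δa≤2 bLow-cTop = s≤s z≤n
δa≤2 bLow-cMid = s≤s (s≤s z≤n)

δb≤2 : ∀ τ → δb τ ≤ 2
δb≤2 aLow-cTop = s≤s z≤n
δb≤2 aLow-cMid = s≤s (s≤s z≤n)
δb≤2 bLow-cTop = z≤n
δb≤2 bLow-cMid = z≤n

δc≤2 : ∀ τ → δc τ ≤ 2
δc≤2 aLow-cTop = s≤s (s≤s z≤n)
δc≤2 aLow-cMid = s≤s z≤n
δc≤2 bLow-cTop = s≤s (s≤s z≤n)
δc≤2 bLow-cMid = s≤s z≤n

δc>0 : ∀ τ → 0 < δc τ
δc>0 aLow-cTop = s≤s z≤n
δc>0 aLow-cMid = s≤s z≤n
δc>0 bLow-cTop = s≤s z≤n
δc>0 bLow-cMid = s≤s z≤n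

δa≢δb : ∀ τ → δa τ ≢ δb τ
δa≢δb aLow-cTop ()
δa≢δb aLow-cMid ()
δa≢δb bLow-cTop ()
δa≢δb bLow-cMid ()

δa≢δc : ∀ τ → δa τ ≢ δc τ
δa≢δc aLow-cTop ()
δa≢δc aLow-cMid ()
δa≢δc bLow-cTop ()
δa≢δc bLow-cMid ()

δb≢δc : ∀ τ → δb τ ≢ δc τ
δb≢δc aLow-cTop ()
δb≢δc aLow-cMid ()
δb≢δc bLow-cTop ()
δb≢δc bLow-cMid ()

module OuterplanarLayout (G : Graph) (π : Fin (n G) → V G) (π-bij : Bijective _≡_ _≡_ π)
  (no-crossing : ∀ a b c d → toℕ a < toℕ b → toℕ b < toℕ c → toℕ c < toℕ d →
                 Edge G (π a) (π c) → Edge G (π b) (π d) → ⊥)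
  (last : ℕ) (n≡1+last : n G ≡ suc last) (1≤last : 1 ≤ last) where

  N : ℕ
  N = n G

  last<N : last < N
  last<N = ≤-reflexive (sym n≡1+last)

  open Numbering G π π-bij (fromℕ< last<N)

  A : ℕ → ℕ → Set
  A p q = Edge G (at p) (at q)

  A? : ∀ p q → Dec (A p q)
  A? p q = adj G (at p) (at q) Bool.≟ true

  chords-cross-free : ∀ {p q r s} → p < q → q < r → r < s → s < N → A p r → A q s → ⊥
  chords-cross-free {p} {q} {r} {s} p<q q<r r<s s<N =
    no-crossing (index p) (index q) (index r) (index s)
      (subst₂ _<_ (sym (toℕ-index p<N)) (sym (toℕ-index q<N)) p<q)
      (subst₂ _<_ (sym (toℕ-index q<N)) (sym (toℕ-index r<N)) q<r)
      (subst₂ _<_ (sym (toℕ-index r<N)) (sym (toℕ-index s<N)) r<s)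
    where
    r<N = <-trans r<s s<N
    q<N = <-trans q<r r<N
    p<N = <-trans p<q q<N

  lastNeighbour : ℕ → ℕ → ℕ
  lastNeighbour a zero    = suc a
  lastNeighbour a (suc k) with A? a (suc a + suc k)
  ... | yes _ = suc a + suc k
  ... | no _  = lastNeighbour a k

  lastNeighbour-> : ∀ a k → a < lastNeighbour a k
  lastNeighbour-> a zero = ≤-refl
  lastNeighbour-> a (suc k) with A? a (suc a + suc k)
  ... | yes _ = m≤m+n (suc a) (suc k)
  ... | no _  = lastNeighbour-> a k

  lastNeighbour-≤ : ∀ a k → lastNeighbour a k ≤ suc a + k
  lastNeighbour-≤ a zero = ≤-reflexive (sym (+-identityʳ (suc a)))
  lastNeighbour-≤ a (suc k) with A? a (suc a + suc k)
  ... | yes _ = ≤-refl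
  ... | no _  = ≤-trans (lastNeighbour-≤ a k) (+-monoʳ-≤ (suc a) (n≤1+n k))

  lastNeighbour-adjacent : ∀ a k → lastNeighbour a k ≡ suc a ⊎ A a (lastNeighbour a k)
  lastNeighbour-adjacent a zero = inj₁ refl
  lastNeighbour-adjacent a (suc k) with A? a (suc a + suc k)
  ... | yes a-c = inj₂ a-c
  ... | no _    = lastNeighbour-adjacent a k

  lastNeighbour-last : ∀ a k {c} → lastNeighbour a k < c → c ≤ suc a + k → ¬ A a c
  lastNeighbour-last a zero l<c c≤ = contradiction (<-≤-trans l<c c≤) (<-irrefl (sym (+-identityʳ (suc a))))
  lastNeighbour-last a (suc k) {c} l<c c≤ with A? a (suc a + suc k)
  ... | yes _ = contradiction (<-≤-trans l<c c≤) (<-irrefl refl)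
  ... | no ¬a-last with c ≟ suc a + suc k
  ...   | yes refl = ¬a-last
  ...   | no c≢last = lastNeighbour-last a k l<c (≤-pred (subst (suc c ≤_) (+-suc (suc a) k) (≤∧≢⇒< c≤ c≢last)))

  -- The apex of a chord (a, b): the last neighbour of a strictly between a + 1 and b, else a + 1.
  apex : ℕ → ℕ → ℕ
  apex a b = lastNeighbour a (b ∸ suc (suc a))

  apex> : ∀ a b → a < apex a b
  apex> a b = lastNeighbour-> a (b ∸ suc (suc a))

  apex< : ∀ {a b} → suc a < b → apex a b < b
  apex< {a} {suc b} (s≤s a<b) = s≤s (≤-trans (lastNeighbour-≤ a (b ∸ suc a)) (≤-reflexive (m+[n∸m]≡n a<b)))

  apex-adjacent : ∀ a b → apex a b ≡ suc a ⊎ A a (apex a b)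
  apex-adjacent a b = lastNeighbour-adjacent a (b ∸ suc (suc a))

  apex-last : ∀ {a b c} → suc a < b → apex a b < c → c < b → ¬ A a c
  apex-last {a} {suc b} (s≤s a<b) apex<c (s≤s c≤b) =
    lastNeighbour-last a (b ∸ suc a) apex<c (≤-trans c≤b (≤-reflexive (sym (m+[n∸m]≡n a<b))))

  apex-triangle : ∀ {x y z} → x < y → y < z → z < N → A x y → A y z → apex x z ≡ y
  apex-triangle {x} {y} {z} x<y y<z z<N x-y y-z with <-cmp (apex x z) y
  ... | tri≈ _ c≡y _ = c≡y
  ... | tri< c<y _ _ = contradiction x-y (apex-last (≤-<-trans x<y y<z) c<y y<z)
  ... | tri> _ _ y<c with apex-adjacent x z
  ...   | inj₁ c≡1+x = contradiction (≤-<-trans x<y y<c) (<-irrefl (sym c≡1+x))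
  ...   | inj₂ x-c   = ⊥-elim (chords-cross-free x<y y<c (apex< (≤-<-trans x<y y<z)) z<N x-c y-z)

  -- The level of p inside the node (a, b) of base level m and shape τ, found by descending
  -- through the decomposition of (a, b) at its apex, with fuel f.
  levelIn : ℕ → ℕ → ℕ → ℕ → Shape → ℕ → ℕ
  levelIn zero    a b m τ p = 0
  levelIn (suc f) a b m τ p with p ≤? a | b ≤? p | <-cmp p (apex a b)
  ... | yes _ | _     | _          = δa τ + m
  ... | no _  | yes _ | _          = δb τ + m
  ... | no _  | no _  | tri< _ _ _ = levelIn f a (apex a b) (leftShift τ + m) (leftShape τ) p
  ... | no _  | no _  | tri≈ _ _ _ = δc τ + m
  ... | no _  | no _  | tri> _ _ _ = levelIn f (apex a b) b (rightShift τ + m) (rightShape τ) p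

  level : ℕ → ℕ
  level = levelIn N 0 last 0 aLow-cTop

  levelIn-a : ∀ f a b m τ → levelIn (suc f) a b m τ a ≡ δa τ + m
  levelIn-a f a b m τ with a ≤? a
  ... | yes _  = refl
  ... | no a≰a = contradiction ≤-refl a≰a

  levelIn-b : ∀ f {a b} m τ → a < b → levelIn (suc f) a b m τ b ≡ δb τ + m
  levelIn-b f {a} {b} m τ a<b with b ≤? a | b ≤? b
  ... | yes b≤a | _      = contradiction b≤a (<⇒≱ a<b)
  ... | no _    | yes _  = refl
  ... | no _    | no b≰b = contradiction ≤-refl b≰b

  levelIn-c : ∀ f {a b} m τ → suc a < b → levelIn (suc f) a b m τ (apex a b) ≡ δc τ + m
  levelIn-c f {a} {b} m τ 1+a<b with apex a b ≤? a | b ≤? apex a b | <-cmp (apex a b) (apex a b)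
  ... | yes c≤a | _       | _          = contradiction c≤a (<⇒≱ (apex> a b))
  ... | no _    | yes b≤c | _          = contradiction b≤c (<⇒≱ (apex< 1+a<b))
  ... | no _    | no _    | tri< c<c _ _ = contradiction c<c (<-irrefl refl)
  ... | no _    | no _    | tri≈ _ _ _   = refl
  ... | no _    | no _    | tri> _ _ c<c = contradiction c<c (<-irrefl refl)

  levelIn-left : ∀ f {a b} m τ {p} → suc a < b → a < p → p < apex a b →
                 levelIn (suc f) a b m τ p ≡ levelIn f a (apex a b) (leftShift τ + m) (leftShape τ) p
  levelIn-left f {a} {b} m τ {p} 1+a<b a<p p<c with p ≤? a | b ≤? p | <-cmp p (apex a b)
  ... | yes p≤a | _       | _            = contradiction p≤a (<⇒≱ a<p)
  ... | no _    | yes b≤p | _            = contradiction b≤p (<⇒≱ (<-trans p<c (apex< 1+a<b)))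
  ... | no _    | no _    | tri< _ _ _   = refl
  ... | no _    | no _    | tri≈ _ p≡c _ = contradiction p≡c (<⇒≢ p<c)
  ... | no _    | no _    | tri> _ _ c<p = contradiction c<p (<-asym p<c)

  levelIn-right : ∀ f {a b} m τ {p} → apex a b < p → p < b →
                  levelIn (suc f) a b m τ p ≡ levelIn f (apex a b) b (rightShift τ + m) (rightShape τ) p
  levelIn-right f {a} {b} m τ {p} c<p p<b with p ≤? a | b ≤? p | <-cmp p (apex a b)
  ... | yes p≤a | _       | _            = contradiction p≤a (<⇒≱ (<-trans (apex> a b) c<p))
  ... | no _    | yes b≤p | _            = contradiction b≤p (<⇒≱ p<b)
  ... | no _    | no _    | tri< p<c _ _ = contradiction c<p (<-asym p<c)
  ... | no _    | no _    | tri≈ _ p≡c _ = contradiction (sym p≡c) (<⇒≢ c<p)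
  ... | no _    | no _    | tri> _ _ _   = refl

  record Node (f a b m : ℕ) (τ : Shape) : Set where
    field
      a<b    : a < b
      b≤a+f  : b ≤ a + f
      b<N    : b < N
      agrees : ∀ {p} → a ≤ p → p ≤ b → level p ≡ levelIn f a b m τ p

  root : Node N 0 last 0 aLow-cTop
  root = record { a<b = 1≤last ; b≤a+f = <⇒≤ last<N ; b<N = last<N ; agrees = λ _ _ → refl }

  fuel-suc : ∀ {f a b} → a < b → b ≤ a + f → ∃ λ f′ → f ≡ suc f′
  fuel-suc {zero}  {a} a<b b≤a+0 = contradiction (<-≤-trans a<b b≤a+0) (<-irrefl (sym (+-identityʳ a)))
  fuel-suc {suc f} _   _         = f , refl

  shifted : ∀ d s {e} m → d + s ≡ e → d + (s + m) ≡ e + m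
  shifted d s m eq = trans (sym (+-assoc d s m)) (cong (_+ m) eq)

  corners : ∀ {f a b m τ} → Node f a b m τ → level a ≡ δa τ + m × level b ≡ δb τ + m
  corners {f} {a} {b} {m} {τ} node with fuel-suc a<b b≤a+f
    where open Node node
  ... | f′ , refl = trans (agrees ≤-refl (<⇒≤ a<b)) (levelIn-a f′ a b m τ) ,
                    trans (agrees (<⇒≤ a<b) ≤-refl) (levelIn-b f′ m τ a<b)
    where open Node node

  module _ {f a b m τ} (node : Node (suc f) a b m τ) (1+a<b : suc a < b) where
    open Node node

    apex-level : level (apex a b) ≡ δc τ + m
    apex-level = trans (agrees (<⇒≤ (apex> a b)) (<⇒≤ (apex< 1+a<b))) (levelIn-c f m τ 1+a<b)

    leftChild : Node f a (apex a b) (leftShift τ + m) (leftShape τ)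
    leftChild = record { a<b = apex> a b ; b≤a+f = c≤a+f ; b<N = <-trans (apex< 1+a<b) b<N ; agrees = agrees′ }
      where
      c≤a+f : apex a b ≤ a + f
      c≤a+f = ≤-pred (≤-trans (apex< 1+a<b) (≤-trans b≤a+f (≤-reflexive (+-suc a f))))
      agrees′ : ∀ {p} → a ≤ p → p ≤ apex a b → level p ≡ levelIn f a (apex a b) (leftShift τ + m) (leftShape τ) p
      agrees′ {p} a≤p p≤c with fuel-suc (apex> a b) c≤a+f
      ... | f′ , refl with m≤n⇒m<n∨m≡n a≤p | m≤n⇒m<n∨m≡n p≤c
      ...   | inj₂ refl | _ = trans (agrees ≤-refl (<⇒≤ a<b))
                                (trans (levelIn-a f a b m τ)
                                  (sym (trans (levelIn-a f′ a _ _ _) (shifted (δa (leftShape τ)) (leftShift τ) m (left-a τ)))))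
      ...   | inj₁ _ | inj₂ refl = trans apex-level
                                     (sym (trans (levelIn-b f′ _ _ (apex> a b)) (shifted (δb (leftShape τ)) (leftShift τ) m (left-b τ))))
      ...   | inj₁ a<p | inj₁ p<c = trans (agrees a≤p (≤-trans p≤c (<⇒≤ (apex< 1+a<b))))
                                      (levelIn-left (suc f′) m τ 1+a<b a<p p<c)

    rightChild : Node f (apex a b) b (rightShift τ + m) (rightShape τ)
    rightChild = record { a<b = apex< 1+a<b ; b≤a+f = b≤c+f ; b<N = b<N ; agrees = agrees′ }
      where
      b≤c+f : b ≤ apex a b + f
      b≤c+f = ≤-trans b≤a+f (≤-trans (≤-reflexive (+-suc a f)) (+-monoˡ-≤ f (apex> a b)))
      agrees′ : ∀ {p} → apex a b ≤ p → p ≤ b → level p ≡ levelIn f (apex a b) b (rightShift τ + m) (rightShape τ) p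
      agrees′ {p} c≤p p≤b with fuel-suc (apex< 1+a<b) b≤c+f
      ... | f′ , refl with m≤n⇒m<n∨m≡n c≤p | m≤n⇒m<n∨m≡n p≤b
      ...   | inj₂ refl | _ = trans apex-level
                                (sym (trans (levelIn-a f′ (apex a b) b (rightShift τ + m) (rightShape τ)) (shifted (δa (rightShape τ)) (rightShift τ) m (right-a τ))))
      ...   | inj₁ _ | inj₂ refl = trans (agrees (<⇒≤ a<b) ≤-refl)
                                     (trans (levelIn-b (suc f′) m τ a<b)
                                       (sym (trans (levelIn-b f′ _ _ (apex< 1+a<b)) (shifted (δb (rightShape τ)) (rightShift τ) m (right-b τ)))))
      ...   | inj₁ c<p | inj₁ p<b = trans (agrees (≤-trans (<⇒≤ (apex> a b)) c≤p) p≤b)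
                                      (levelIn-right (suc f′) m τ c<p p<b)

  above-base : ∀ {f a b m τ p} → Node f a b m τ → a < p → p < b → m < level p
  above-base {zero} node a<p p<b = contradiction (fuel-suc (Node.a<b node) (Node.b≤a+f node)) λ ()
  above-base {suc f} {a} {b} {m} {τ} {p} node a<p p<b with <-cmp p (apex a b)
  ... | tri< p<c _ _ = ≤-<-trans (m≤n+m m (leftShift τ)) (above-base (leftChild node 1+a<b) a<p p<c)
    where 1+a<b = ≤-<-trans a<p p<b
  ... | tri≈ _ refl _ = subst (m <_) (sym (apex-level node (≤-<-trans a<p p<b))) (+-monoˡ-≤ m (δc>0 τ))
  ... | tri> _ _ c<p = ≤-<-trans (m≤n+m m (rightShift τ)) (above-base (rightChild node 1+a<b) c<p p<b)
    where 1+a<b = ≤-<-trans a<p p<b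

  atNode : ℕ → ℕ → ℕ → List (List ℕ)
  atNode a c b = (a ∷ c ∷ b ∷ []) ∷ (a ∷ b ∷ []) ∷ (c ∷ []) ∷ []

  -- Chosen for each shape so that positions on a common level come in increasing order.
  arrange : Shape → List (List ℕ) → List (List ℕ) → List (List ℕ) → List (List ℕ)
  arrange aLow-cTop L M R = L ++ M ++ R
  arrange bLow-cTop L M R = L ++ M ++ R
  arrange aLow-cMid L M R = L ++ R ++ M
  arrange bLow-cMid L M R = M ++ L ++ R

  traversal : ℕ → ℕ → ℕ → ℕ → Shape → List (List ℕ)
  traversal zero    a b m τ = []
  traversal (suc f) a b m τ with suc a <? b
  ... | no _  = (a ∷ b ∷ []) ∷ []
  ... | yes _ = arrange τ (traversal f a (apex a b) (leftShift τ + m) (leftShape τ))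
                          (atNode a (apex a b) b)
                          (traversal f (apex a b) b (rightShift τ + m) (rightShape τ))

  private
    ∈-++³⁻ : ∀ {A : Set} (X Y : List A) {Z x} → x ∈ₗ X ++ Y ++ Z → x ∈ₗ X ⊎ x ∈ₗ Y ⊎ x ∈ₗ Z
    ∈-++³⁻ X Y x∈ with ∈-++⁻ X x∈
    ... | inj₁ x∈X = inj₁ x∈X
    ... | inj₂ x∈YZ with ∈-++⁻ Y x∈YZ
    ...   | inj₁ x∈Y = inj₂ (inj₁ x∈Y)
    ...   | inj₂ x∈Z = inj₂ (inj₂ x∈Z)

  ∈-arrange⁻ : ∀ τ L M R {ps} → ps ∈ₗ arrange τ L M R → ps ∈ₗ L ⊎ ps ∈ₗ M ⊎ ps ∈ₗ R
  ∈-arrange⁻ aLow-cTop L M R ps∈ = ∈-++³⁻ L M ps∈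
  ∈-arrange⁻ bLow-cTop L M R ps∈ = ∈-++³⁻ L M ps∈
  ∈-arrange⁻ aLow-cMid L M R ps∈ with ∈-++³⁻ L R ps∈
  ... | inj₁ ps∈L        = inj₁ ps∈L
  ... | inj₂ (inj₁ ps∈R) = inj₂ (inj₂ ps∈R)
  ... | inj₂ (inj₂ ps∈M) = inj₂ (inj₁ ps∈M)
  ∈-arrange⁻ bLow-cMid L M R ps∈ with ∈-++³⁻ M L ps∈
  ... | inj₁ ps∈M        = inj₂ (inj₁ ps∈M)
  ... | inj₂ (inj₁ ps∈L) = inj₁ ps∈L
  ... | inj₂ (inj₂ ps∈R) = inj₂ (inj₂ ps∈R)

  ∈-arrange⁺ : ∀ τ L M R {ps} → ps ∈ₗ L ⊎ ps ∈ₗ M ⊎ ps ∈ₗ R → ps ∈ₗ arrange τ L M R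
  ∈-arrange⁺ aLow-cTop L M R (inj₁ ps∈L)        = ∈-++⁺ˡ ps∈L
  ∈-arrange⁺ aLow-cTop L M R (inj₂ (inj₁ ps∈M)) = ∈-++⁺ʳ L (∈-++⁺ˡ ps∈M)
  ∈-arrange⁺ aLow-cTop L M R (inj₂ (inj₂ ps∈R)) = ∈-++⁺ʳ L (∈-++⁺ʳ M ps∈R)
  ∈-arrange⁺ bLow-cTop L M R (inj₁ ps∈L)        = ∈-++⁺ˡ ps∈L
  ∈-arrange⁺ bLow-cTop L M R (inj₂ (inj₁ ps∈M)) = ∈-++⁺ʳ L (∈-++⁺ˡ ps∈M)
  ∈-arrange⁺ bLow-cTop L M R (inj₂ (inj₂ ps∈R)) = ∈-++⁺ʳ L (∈-++⁺ʳ M ps∈R)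
  ∈-arrange⁺ aLow-cMid L M R (inj₁ ps∈L)        = ∈-++⁺ˡ ps∈L
  ∈-arrange⁺ aLow-cMid L M R (inj₂ (inj₁ ps∈M)) = ∈-++⁺ʳ L (∈-++⁺ʳ R ps∈M)
  ∈-arrange⁺ aLow-cMid L M R (inj₂ (inj₂ ps∈R)) = ∈-++⁺ʳ L (∈-++⁺ˡ ps∈R)
  ∈-arrange⁺ bLow-cMid L M R (inj₁ ps∈L)        = ∈-++⁺ʳ M (∈-++⁺ˡ ps∈L)
  ∈-arrange⁺ bLow-cMid L M R (inj₂ (inj₁ ps∈M)) = ∈-++⁺ˡ ps∈M
  ∈-arrange⁺ bLow-cMid L M R (inj₂ (inj₂ ps∈R)) = ∈-++⁺ʳ M (∈-++⁺ʳ L ps∈R)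

  traversal-leaf : ∀ {f a b m τ} → b ≤ suc a → traversal (suc f) a b m τ ≡ (a ∷ b ∷ []) ∷ []
  traversal-leaf {a = a} {b} b≤1+a with suc a <? b
  ... | no _      = refl
  ... | yes 1+a<b = contradiction 1+a<b (≤⇒≯ b≤1+a)

  module _ {f a b m τ} (node : Node (suc f) a b m τ) (1+a<b : suc a < b) where

    traversal-split : traversal (suc f) a b m τ ≡
      arrange τ (traversal f a (apex a b) (leftShift τ + m) (leftShape τ)) (atNode a (apex a b) b)
                (traversal f (apex a b) b (rightShift τ + m) (rightShape τ))
    traversal-split with suc a <? b
    ... | yes _      = refl
    ... | no 1+a≮b = contradiction 1+a<b 1+a≮b

    ∈-traversal-left : ∀ {ps} → ps ∈ₗ traversal f a (apex a b) (leftShift τ + m) (leftShape τ) →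
                       ps ∈ₗ traversal (suc f) a b m τ
    ∈-traversal-left ps∈ = subst (_ ∈ₗ_) (sym traversal-split) (∈-arrange⁺ τ _ _ _ (inj₁ ps∈))

    ∈-traversal-node : ∀ {ps} → ps ∈ₗ atNode a (apex a b) b → ps ∈ₗ traversal (suc f) a b m τ
    ∈-traversal-node ps∈ = subst (_ ∈ₗ_) (sym traversal-split) (∈-arrange⁺ τ _ _ _ (inj₂ (inj₁ ps∈)))

    ∈-traversal-right : ∀ {ps} → ps ∈ₗ traversal f (apex a b) b (rightShift τ + m) (rightShape τ) →
                        ps ∈ₗ traversal (suc f) a b m τ
    ∈-traversal-right ps∈ = subst (_ ∈ₗ_) (sym traversal-split) (∈-arrange⁺ τ _ _ _ (inj₂ (inj₂ ps∈)))

  no-fuel : ∀ {a b m τ} → ¬ Node zero a b m τ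
  no-fuel node = contradiction (fuel-suc (Node.a<b node) (Node.b≤a+f node)) λ ()

  chord-side : ∀ {a b x y} → suc a < b → b < N → a ≤ x → x < y → y ≤ b → A x y → ¬ (x ≡ a × y ≡ b) →
               y ≤ apex a b ⊎ apex a b ≤ x
  chord-side {a} {b} {x} {y} 1+a<b b<N a≤x x<y y≤b x-y not-ab with y ≤? apex a b | apex a b ≤? x
  ... | yes y≤c | _       = inj₁ y≤c
  ... | no _    | yes c≤x = inj₂ c≤x
  ... | no y≰c  | no c≰x with m≤n⇒m<n∨m≡n a≤x
  ...   | inj₂ refl = contradiction x-y (apex-last 1+a<b (≰⇒> y≰c) (≤∧≢⇒< y≤b λ y≡b → not-ab (refl , y≡b)))
  ...   | inj₁ a<x with apex-adjacent a b
  ...     | inj₁ c≡1+a = contradiction (≤-<-trans a<x (≰⇒> c≰x)) (<-irrefl (sym c≡1+a))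
  ...     | inj₂ a-c = ⊥-elim (chords-cross-free a<x (≰⇒> c≰x) (≰⇒> y≰c) (≤-<-trans y≤b b<N) a-c x-y)

  Subnode : ℕ → ℕ → ℕ → ℕ → Shape → ℕ → ℕ → Set
  Subnode f a b m τ x y = Σ ℕ λ f′ → Σ ℕ λ m′ → Σ Shape λ τ′ →
    Node f′ x y m′ τ′ × (∀ {ps} → ps ∈ₗ traversal f′ x y m′ τ′ → ps ∈ₗ traversal f a b m τ)

  -- Outerplanarity makes every chord a node of the decomposition.
  chord-node : ∀ {f a b m τ x y} → Node f a b m τ → a ≤ x → x < y → y ≤ b → A x y → Subnode f a b m τ x y
  chord-node {zero} node _ _ _ _ = contradiction node no-fuel
  chord-node {suc f} {a} {b} {m} {τ} {x} {y} node a≤x x<y y≤b x-y with (x ≟ a) ×-dec (y ≟ b)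
  ... | yes (refl , refl) = suc f , m , τ , node , λ ps∈ → ps∈
  ... | no not-ab with ≤-<-connex b (suc a)
  ...   | inj₁ b≤1+a = ⊥-elim (not-ab (≤-antisym (≤-pred (≤-trans x<y (≤-trans y≤b b≤1+a))) a≤x ,
                                       ≤-antisym y≤b (≤-trans b≤1+a (≤-trans (s≤s a≤x) x<y))))
  ...   | inj₂ 1+a<b with chord-side 1+a<b (Node.b<N node) a≤x x<y y≤b x-y not-ab
  ...     | inj₁ y≤c = let f′ , m′ , τ′ , sub , sub⊆ = chord-node (leftChild node 1+a<b) a≤x x<y y≤c x-y
                       in f′ , m′ , τ′ , sub , λ ps∈ → ∈-traversal-left node 1+a<b (sub⊆ ps∈)
  ...     | inj₂ c≤x = let f′ , m′ , τ′ , sub , sub⊆ = chord-node (rightChild node 1+a<b) c≤x x<y y≤b x-y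
                       in f′ , m′ , τ′ , sub , λ ps∈ → ∈-traversal-right node 1+a<b (sub⊆ ps∈)

  chord∈traversal : ∀ {f a b m τ} → Node f a b m τ → (a ∷ b ∷ []) ∈ₗ traversal f a b m τ
  chord∈traversal {zero} node = contradiction node no-fuel
  chord∈traversal {suc f} {a} {b} {m} {τ} node with ≤-<-connex b (suc a)
  ... | inj₁ b≤1+a = subst (_ ∈ₗ_) (sym (traversal-leaf {f} {a} {b} {m} {τ} b≤1+a)) (here refl)
  ... | inj₂ 1+a<b = ∈-traversal-node node 1+a<b (there (here refl))

  triangle∈traversal : ∀ {f a b m τ} → Node f a b m τ → suc a < b →
                       (a ∷ apex a b ∷ b ∷ []) ∈ₗ traversal f a b m τ
  triangle∈traversal {zero} node _ = contradiction node no-fuel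
  triangle∈traversal {suc f} node 1+a<b = ∈-traversal-node node 1+a<b (here refl)

  apex∈traversal : ∀ {f a b m τ x} → Node f a b m τ → a < x → x < b → (x ∷ []) ∈ₗ traversal f a b m τ
  apex∈traversal {zero} node _ _ = contradiction node no-fuel
  apex∈traversal {suc f} {a} {b} {x = x} node a<x x<b with <-cmp x (apex a b)
  ... | tri< x<c _ _  = ∈-traversal-left node 1+a<b (apex∈traversal (leftChild node 1+a<b) a<x x<c)
    where 1+a<b = ≤-<-trans a<x x<b
  ... | tri≈ _ refl _ = ∈-traversal-node node (≤-<-trans a<x x<b) (there (there (here refl)))
  ... | tri> _ _ c<x  = ∈-traversal-right node 1+a<b (apex∈traversal (rightChild node 1+a<b) c<x x<b)
    where 1+a<b = ≤-<-trans a<x x<b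

  traversal-within : ∀ {f a b m τ} → Node f a b m τ → ∀ {ps p} → ps ∈ₗ traversal f a b m τ → p ∈ₗ ps →
                     a ≤ p × p ≤ b
  traversal-within {zero} node = contradiction node no-fuel
  traversal-within {suc f} {a} {b} {m} {τ} node ps∈ p∈ with ≤-<-connex b (suc a)
  ... | inj₁ b≤1+a = leaf (subst (_ ∈ₗ_) (traversal-leaf {f} {a} {b} {m} {τ} b≤1+a) ps∈) p∈
    where
    leaf : ∀ {ps p} → ps ∈ₗ (a ∷ b ∷ []) ∷ [] → p ∈ₗ ps → a ≤ p × p ≤ b
    leaf (here refl) (here refl)         = ≤-refl , <⇒≤ (Node.a<b node)
    leaf (here refl) (there (here refl)) = <⇒≤ (Node.a<b node) , ≤-refl
  ... | inj₂ 1+a<b with ∈-arrange⁻ τ _ _ _ (subst (_ ∈ₗ_) (traversal-split node 1+a<b) ps∈)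
  ...   | inj₁ ps∈L =
    let a≤p , p≤c = traversal-within (leftChild node 1+a<b) ps∈L p∈ in a≤p , ≤-trans p≤c (<⇒≤ (apex< 1+a<b))
  ...   | inj₂ (inj₂ ps∈R) =
    let c≤p , p≤b = traversal-within (rightChild node 1+a<b) ps∈R p∈ in ≤-trans (<⇒≤ (apex> a b)) c≤p , p≤b
  ...   | inj₂ (inj₁ ps∈M) = corner ps∈M p∈
    where
    a<b = Node.a<b node
    corner : ∀ {ps p} → ps ∈ₗ atNode a (apex a b) b → p ∈ₗ ps → a ≤ p × p ≤ b
    corner (here refl) (here refl)                 = ≤-refl , <⇒≤ a<b
    corner (here refl) (there (here refl))         = <⇒≤ (apex> a b) , <⇒≤ (apex< 1+a<b)
    corner (here refl) (there (there (here refl))) = <⇒≤ a<b , ≤-refl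
    corner (there (here refl)) (here refl)         = ≤-refl , <⇒≤ a<b
    corner (there (here refl)) (there (here refl)) = <⇒≤ a<b , ≤-refl
    corner (there (there (here refl))) (here refl) = <⇒≤ (apex> a b) , <⇒≤ (apex< 1+a<b)

  chord-levels : ∀ {x y} → x < y → y < N → A x y →
                 Σ ℕ λ m → Σ Shape λ τ → level x ≡ δa τ + m × level y ≡ δb τ + m ×
                                         (∀ {r} → x < r → r < y → m < level r)
  chord-levels x<y y<N x-y =
    let _ , m , τ , node , _ = chord-node root z≤n x<y (≤-pred (subst (_ <_) n≡1+last y<N)) x-y
        level-x , level-y = corners node
    in m , τ , level-x , level-y , above-base node

  -- One end of a chord is on the base level of its node, strictly below everything inside.
  nested-same-levels : ∀ {p q r s} → p < q → q < N → A p q → p < r → r < q → p < s → s < q →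
                       level r ≡ level p → level s ≡ level q → ⊥
  nested-same-levels p<q q<N p-q p<r r<q p<s s<q r≡p s≡q with chord-levels p<q q<N p-q
  ... | m , τ , level-p , level-q , inside with δa⊎δb≡0 τ
  ...   | inj₁ δa≡0 = <-irrefl (sym (trans r≡p (trans level-p (cong (_+ m) δa≡0)))) (inside p<r r<q)
  ...   | inj₂ δb≡0 = <-irrefl (sym (trans s≡q (trans level-q (cong (_+ m) δb≡0)))) (inside p<s s<q)

  chord-level-bounds : ∀ {p q} → p < q → q < N → A p q →
                       level p ≢ level q × level p ≤ 2 + level q × level q ≤ 2 + level p
  chord-level-bounds p<q q<N p-q with chord-levels p<q q<N p-q
  ... | m , τ , level-p , level-q , _ =
    (λ p≡q → δa≢δb τ (+-cancelʳ-≡ m _ _ (trans (sym level-p) (trans p≡q level-q)))) ,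
    subst₂ (λ s t → s ≤ 2 + t) (sym level-p) (sym level-q) (+-mono-≤ (δa≤2 τ) (m≤n+m m (δb τ))) ,
    subst₂ (λ s t → s ≤ 2 + t) (sym level-q) (sym level-p) (+-mono-≤ (δb≤2 τ) (m≤n+m m (δa τ)))

  vertexLevel : V G → ℕ
  vertexLevel v = level (pos v)

  rankOf : V G → ℕ
  rankOf v = vertexLevel v * N + pos v

  A-pos : ∀ {u v} → Edge G u v → A (pos u) (pos v)
  A-pos {u} {v} e = subst₂ (Edge G) (sym (at-pos u)) (sym (at-pos v)) e

  pos-edge≢ : ∀ {u v} → Edge G u v → pos u ≢ pos v
  pos-edge≢ {u} e eq = edge-irrefl G (subst (Edge G u) (sym (pos-injective eq)) e)

  edge-level-bounds : ∀ {u v} → Edge G u v →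
                      vertexLevel u ≢ vertexLevel v × vertexLevel v ≤ 2 + vertexLevel u
  edge-level-bounds {u} {v} e with <-cmp (pos u) (pos v)
  ... | tri< pu<pv _ _ = let ≢ , _ , ≤ = chord-level-bounds pu<pv (pos<n v) (A-pos e) in ≢ , ≤
  ... | tri≈ _ pu≡pv _ = contradiction pu≡pv (pos-edge≢ e)
  ... | tri> _ _ pv<pu = let ≢ , ≤ , _ = chord-level-bounds pv<pu (pos<n u) (A-pos (edge-sym G e)) in (λ eq → ≢ (sym eq)) , ≤

  rank-injective : ∀ {u v} → rankOf u ≡ rankOf v → u ≡ v
  rank-injective {u} {v} eq = pos-injective (proj₂ (lex-injective N {vertexLevel u} {vertexLevel v} (pos<n u) (pos<n v) eq))

  rank-levelwise : ∀ {u v} → vertexLevel u < vertexLevel v → rankOf u < rankOf v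
  rank-levelwise {u} lu<lv = lex-< N lu<lv (pos<n u)

  open Levelled G 5 2 ≤-refl vertexLevel rankOf rank-injective rank-levelwise
                (λ e → proj₁ (edge-level-bounds e)) (λ e → proj₂ (edge-level-bounds e))

  sameLevel-pos< : ∀ {u x} → vertexLevel u ≡ vertexLevel x → rankOf u < rankOf x → pos u < pos x
  sameLevel-pos< {u} {x} lu≡lx ru<rx = +-cancelˡ-< (vertexLevel x * N) (pos u) (pos x)
                                         (subst (λ l → l * N + pos u < rankOf x) lu≡lx ru<rx)

  crossingFree : SameLevelCrossingFree
  crossingFree {u} {v} {x} {y} e₁ e₂ lu≡lx lv≡ly ru<rx ry<rv with <-cmp (pos u) (pos v)
  ... | tri≈ _ pu≡pv _ = pos-edge≢ e₁ pu≡pv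
  ... | tri> _ _ pv<pu =
    nested-same-levels (<-trans py<pv (<-trans pv<pu pu<px)) (pos<n x) (A-pos (edge-sym G e₂))
      py<pv (<-trans pv<pu pu<px) (<-trans py<pv pv<pu) pu<px lv≡ly lu≡lx
    where
    pu<px = sameLevel-pos< lu≡lx ru<rx
    py<pv = sameLevel-pos< (sym lv≡ly) ry<rv
  ... | tri< pu<pv _ _ with <-cmp (pos x) (pos v) | <-cmp (pos u) (pos y)
  ...   | tri≈ _ px≡pv _ | _ = proj₁ (edge-level-bounds e₁) (trans lu≡lx (cong level px≡pv))
  ...   | _ | tri≈ _ pu≡py _ = proj₁ (edge-level-bounds e₁) (trans (cong level pu≡py) (sym lv≡ly))
  ...   | tri< px<pv _ _ | tri< pu<py _ _ =
    nested-same-levels pu<pv (pos<n v) (A-pos e₁) pu<px px<pv pu<py py<pv (sym lu≡lx) (sym lv≡ly)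
    where
    pu<px = sameLevel-pos< lu≡lx ru<rx
    py<pv = sameLevel-pos< (sym lv≡ly) ry<rv
  ...   | tri< px<pv _ _ | tri> _ _ py<pu =
    chords-cross-free py<pu (sameLevel-pos< lu≡lx ru<rx) px<pv (pos<n v) (A-pos (edge-sym G e₂)) (A-pos e₁)
  ...   | tri> _ _ pv<px | tri< pu<py _ _ =
    chords-cross-free pu<py (sameLevel-pos< (sym lv≡ly) ry<rv) pv<px (pos<n x) (A-pos e₁) (A-pos (edge-sym G e₂))
  ...   | tri> _ _ pv<px | tri> _ _ py<pu =
    nested-same-levels (<-trans py<pu (<-trans pu<pv pv<px)) (pos<n x) (A-pos (edge-sym G e₂))
      (<-trans py<pu pu<pv) pv<px py<pu (<-trans pu<pv pv<px) lv≡ly lu≡lx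

  L : TrackLayout G 5
  L = layout crossingFree

  SameLevelOrdered : List ℕ → List ℕ → Set
  SameLevelOrdered ps qs = ∀ {p q} → p ∈ₗ ps → q ∈ₗ qs → level p ≡ level q → p ≤ q

  Within : ℕ → ℕ → List ℕ → Set
  Within x y ps = ∀ {p} → p ∈ₗ ps → x ≤ p × p ≤ y

  module NodeOrder {f a b m τ} (node : Node (suc f) a b m τ) (1+a<b : suc a < b) where

    c = apex a b

    OnCorners : List ℕ → Set
    OnCorners ps = ∀ {p} → p ∈ₗ ps → p ≡ a ⊎ p ≡ c ⊎ p ≡ b

    level-a : level a ≡ δa τ + m
    level-a = proj₁ (corners node)

    level-b : level b ≡ δb τ + m
    level-b = proj₂ (corners node)

    level-c : level c ≡ δc τ + m
    level-c = apex-level node 1+a<b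

    offsets≡ : ∀ {p q d e} → level p ≡ d + m → level q ≡ e + m → level p ≡ level q → d ≡ e
    offsets≡ {d = d} {e} level-p level-q p≡q = +-cancelʳ-≡ m d e (trans (sym level-p) (trans p≡q level-q))

    left-cases : ∀ {p} → a ≤ p → p ≤ c → p ≡ a ⊎ p ≡ c ⊎ leftShift τ + m < level p
    left-cases a≤p p≤c with m≤n⇒m<n∨m≡n a≤p | m≤n⇒m<n∨m≡n p≤c
    ... | inj₂ a≡p | _         = inj₁ (sym a≡p)
    ... | inj₁ _   | inj₂ p≡c  = inj₂ (inj₁ p≡c)
    ... | inj₁ a<p | inj₁ p<c  = inj₂ (inj₂ (above-base (leftChild node 1+a<b) a<p p<c))

    right-cases : ∀ {p} → c ≤ p → p ≤ b → p ≡ c ⊎ p ≡ b ⊎ rightShift τ + m < level p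
    right-cases c≤p p≤b with m≤n⇒m<n∨m≡n c≤p | m≤n⇒m<n∨m≡n p≤b
    ... | inj₂ c≡p | _         = inj₁ (sym c≡p)
    ... | inj₁ _   | inj₂ p≡b  = inj₂ (inj₁ p≡b)
    ... | inj₁ c<p | inj₁ p<b  = inj₂ (inj₂ (above-base (rightChild node 1+a<b) c<p p<b))

    left-before-right : ∀ {ps qs} → Within a c ps → Within c b qs → SameLevelOrdered ps qs
    left-before-right in-ps in-qs p∈ q∈ _ = ≤-trans (proj₂ (in-ps p∈)) (proj₁ (in-qs q∈))

    left-before-node : δa τ ≡ leftShift τ → ∀ {ps qs} → Within a c ps → OnCorners qs → SameLevelOrdered ps qs
    left-before-node δa≡ in-ps on-qs p∈ q∈ p≡q with on-qs q∈ | in-ps p∈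
    ... | inj₂ (inj₁ refl) | _ , p≤c = p≤c
    ... | inj₂ (inj₂ refl) | _ , p≤c = ≤-trans p≤c (<⇒≤ (apex< 1+a<b))
    ... | inj₁ refl        | a≤p , p≤c with left-cases a≤p p≤c
    ...   | inj₁ refl        = ≤-refl
    ...   | inj₂ (inj₁ refl) = contradiction (offsets≡ level-a level-c (sym p≡q)) (δa≢δc τ)
    ...   | inj₂ (inj₂ above) = contradiction above (<-irrefl (sym (trans p≡q (trans level-a (cong (_+ m) δa≡)))))

    node-before-right : δb τ ≡ rightShift τ → ∀ {ps qs} → OnCorners ps → Within c b qs → SameLevelOrdered ps qs
    node-before-right δb≡ on-ps in-qs p∈ q∈ p≡q with on-ps p∈ | in-qs q∈
    ... | inj₁ refl        | c≤q , _ = ≤-trans (<⇒≤ (apex> a b)) c≤q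
    ... | inj₂ (inj₁ refl) | c≤q , _ = c≤q
    ... | inj₂ (inj₂ refl) | c≤q , q≤b with right-cases c≤q q≤b
    ...   | inj₁ refl         = contradiction (offsets≡ level-b level-c p≡q) (δb≢δc τ)
    ...   | inj₂ (inj₁ refl)  = ≤-refl
    ...   | inj₂ (inj₂ above) = contradiction above (<-irrefl (sym (trans (sym p≡q) (trans level-b (cong (_+ m) δb≡)))))

    right-before-node : δc τ ≡ rightShift τ → δa τ ≡ 0 → ∀ {ps qs} → Within c b ps → OnCorners qs →
                        SameLevelOrdered ps qs
    right-before-node δc≡ δa≡0 in-ps on-qs p∈ q∈ p≡q with on-qs q∈ | in-ps p∈
    ... | inj₂ (inj₂ refl) | _ , p≤b = p≤b
    ... | inj₂ (inj₁ refl) | c≤p , p≤b with right-cases c≤p p≤b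
    ...   | inj₁ refl         = ≤-refl
    ...   | inj₂ (inj₁ refl)  = contradiction (offsets≡ level-b level-c p≡q) (δb≢δc τ)
    ...   | inj₂ (inj₂ above) = contradiction above (<-irrefl (sym (trans p≡q (trans level-c (cong (_+ m) δc≡)))))
    right-before-node δc≡ δa≡0 in-ps on-qs p∈ q∈ p≡q
      | inj₁ refl | c≤p , p≤b with right-cases c≤p p≤b
    ...   | inj₁ refl         = contradiction (offsets≡ level-a level-c (sym p≡q)) (δa≢δc τ)
    ...   | inj₂ (inj₁ refl)  = contradiction (offsets≡ level-a level-b (sym p≡q)) (δa≢δb τ)
    ...   | inj₂ (inj₂ above) = contradiction (≤-<-trans (m≤n+m m (rightShift τ)) above)
                                  (<-irrefl (sym (trans p≡q (trans level-a (cong (_+ m) δa≡0)))))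

    node-before-left : δc τ ≡ leftShift τ → δb τ ≡ 0 → ∀ {ps qs} → OnCorners ps → Within a c qs →
                       SameLevelOrdered ps qs
    node-before-left δc≡ δb≡0 on-ps in-qs p∈ q∈ p≡q with on-ps p∈ | in-qs q∈
    ... | inj₁ refl        | a≤q , _ = a≤q
    ... | inj₂ (inj₁ refl) | a≤q , q≤c with left-cases a≤q q≤c
    ...   | inj₁ refl         = contradiction (offsets≡ level-a level-c (sym p≡q)) (δa≢δc τ)
    ...   | inj₂ (inj₁ refl)  = ≤-refl
    ...   | inj₂ (inj₂ above) = contradiction above (<-irrefl (sym (trans (sym p≡q) (trans level-c (cong (_+ m) δc≡)))))
    node-before-left δc≡ δb≡0 on-ps in-qs p∈ q∈ p≡q
      | inj₂ (inj₂ refl) | a≤q , q≤c with left-cases a≤q q≤c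
    ...   | inj₁ refl         = contradiction (offsets≡ level-a level-b (sym p≡q)) (δa≢δb τ)
    ...   | inj₂ (inj₁ refl)  = contradiction (offsets≡ level-b level-c p≡q) (δb≢δc τ)
    ...   | inj₂ (inj₂ above) = contradiction (≤-<-trans (m≤n+m m (leftShift τ)) above)
                                  (<-irrefl (sym (trans (sym p≡q) (trans level-b (cong (_+ m) δb≡0)))))

    within-node : ∀ {ps qs} → OnCorners ps → OnCorners qs → SameLevelOrdered ps qs
    within-node on-ps on-qs p∈ q∈ p≡q = ≤-reflexive (same-corner (on-ps p∈) (on-qs q∈) p≡q)
      where
      same-corner : ∀ {p q} → p ≡ a ⊎ p ≡ c ⊎ p ≡ b → q ≡ a ⊎ q ≡ c ⊎ q ≡ b → level p ≡ level q → p ≡ q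
      same-corner (inj₁ refl)        (inj₁ refl)        _ = refl
      same-corner (inj₂ (inj₁ refl)) (inj₂ (inj₁ refl)) _ = refl
      same-corner (inj₂ (inj₂ refl)) (inj₂ (inj₂ refl)) _ = refl
      same-corner (inj₁ refl)        (inj₂ (inj₁ refl)) eq = contradiction (offsets≡ level-a level-c eq) (δa≢δc τ)
      same-corner (inj₁ refl)        (inj₂ (inj₂ refl)) eq = contradiction (offsets≡ level-a level-b eq) (δa≢δb τ)
      same-corner (inj₂ (inj₁ refl)) (inj₁ refl)        eq = contradiction (offsets≡ level-a level-c (sym eq)) (δa≢δc τ)
      same-corner (inj₂ (inj₁ refl)) (inj₂ (inj₂ refl)) eq = contradiction (offsets≡ level-b level-c (sym eq)) (δb≢δc τ)
      same-corner (inj₂ (inj₂ refl)) (inj₁ refl)        eq = contradiction (offsets≡ level-a level-b (sym eq)) (δa≢δb τ)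
      same-corner (inj₂ (inj₂ refl)) (inj₂ (inj₁ refl)) eq = contradiction (offsets≡ level-b level-c eq) (δb≢δc τ)

    atNode-corners : ∀ {ps} → ps ∈ₗ atNode a c b → OnCorners ps
    atNode-corners (here refl) (here refl)                 = inj₁ refl
    atNode-corners (here refl) (there (here refl))         = inj₂ (inj₁ refl)
    atNode-corners (here refl) (there (there (here refl))) = inj₂ (inj₂ refl)
    atNode-corners (there (here refl)) (here refl)         = inj₁ refl
    atNode-corners (there (here refl)) (there (here refl)) = inj₂ (inj₂ refl)
    atNode-corners (there (there (here refl))) (here refl) = inj₂ (inj₁ refl)

    atNode-ordered : AllPairs SameLevelOrdered (atNode a c b)
    atNode-ordered =
      All.tabulate (λ qs∈ → within-node (atNode-corners (here refl)) (atNode-corners (there qs∈))) ∷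
      All.tabulate (λ qs∈ → within-node (atNode-corners (there (here refl))) (atNode-corners (there (there qs∈)))) ∷
      [] ∷ []

  private
    across-++ : ∀ {R : List ℕ → List ℕ → Set} {X} Y {Z} → (∀ {x y} → x ∈ₗ X → y ∈ₗ Y → R x y) →
                (∀ {x z} → x ∈ₗ X → z ∈ₗ Z → R x z) → ∀ {x y} → x ∈ₗ X → y ∈ₗ Y ++ Z → R x y
    across-++ Y toY toZ x∈ y∈ with ∈-++⁻ Y y∈
    ... | inj₁ y∈Y = toY x∈ y∈Y
    ... | inj₂ y∈Z = toZ x∈ y∈Z

  arrange-ordered : ∀ {f a b m} τ (node : Node (suc f) a b m τ) (1+a<b : suc a < b) {Lx Rx} →
    AllPairs SameLevelOrdered Lx → AllPairs SameLevelOrdered Rx →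
    (∀ {ps} → ps ∈ₗ Lx → Within a (apex a b) ps) → (∀ {ps} → ps ∈ₗ Rx → Within (apex a b) b ps) →
    AllPairs SameLevelOrdered (arrange τ Lx (atNode a (apex a b) b) Rx)
  arrange-ordered aLow-cTop node 1+a<b ordL ordR inL inR =
    AllPairs-++⁺ ordL (AllPairs-++⁺ atNode-ordered ordR λ p∈ q∈ → node-before-right refl (atNode-corners p∈) (inR q∈))
      (across-++ {R = SameLevelOrdered} (atNode _ _ _) (λ p∈ q∈ → left-before-node refl (inL p∈) (atNode-corners q∈))
                                (λ p∈ q∈ → left-before-right (inL p∈) (inR q∈)))
    where open NodeOrder node 1+a<b
  arrange-ordered bLow-cTop node 1+a<b ordL ordR inL inR =
    AllPairs-++⁺ ordL (AllPairs-++⁺ atNode-ordered ordR λ p∈ q∈ → node-before-right refl (atNode-corners p∈) (inR q∈))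
      (across-++ {R = SameLevelOrdered} (atNode _ _ _) (λ p∈ q∈ → left-before-node refl (inL p∈) (atNode-corners q∈))
                                (λ p∈ q∈ → left-before-right (inL p∈) (inR q∈)))
    where open NodeOrder node 1+a<b
  arrange-ordered aLow-cMid node 1+a<b {Rx = Rx} ordL ordR inL inR =
    AllPairs-++⁺ ordL (AllPairs-++⁺ ordR atNode-ordered λ p∈ q∈ → right-before-node refl refl (inR p∈) (atNode-corners q∈))
      (across-++ {R = SameLevelOrdered} Rx (λ p∈ q∈ → left-before-right (inL p∈) (inR q∈))
                    (λ p∈ q∈ → left-before-node refl (inL p∈) (atNode-corners q∈)))
    where open NodeOrder node 1+a<b
  arrange-ordered bLow-cMid node 1+a<b {Lx = Lx} ordL ordR inL inR =
    AllPairs-++⁺ atNode-ordered (AllPairs-++⁺ ordL ordR λ p∈ q∈ → left-before-right (inL p∈) (inR q∈))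
      (across-++ {R = SameLevelOrdered} Lx (λ p∈ q∈ → node-before-left refl refl (atNode-corners p∈) (inL q∈))
                    (λ p∈ q∈ → node-before-right refl (atNode-corners p∈) (inR q∈)))
    where open NodeOrder node 1+a<b

  traversal-ordered : ∀ {f a b m τ} → Node f a b m τ → AllPairs SameLevelOrdered (traversal f a b m τ)
  traversal-ordered {zero} node = contradiction node no-fuel
  traversal-ordered {suc f} {a} {b} {m} {τ} node with ≤-<-connex b (suc a)
  ... | inj₁ b≤1+a = subst (AllPairs SameLevelOrdered) (sym (traversal-leaf {f} {a} {b} {m} {τ} b≤1+a)) ([] ∷ [])
  ... | inj₂ 1+a<b = subst (AllPairs SameLevelOrdered) (sym (traversal-split node 1+a<b))
      (arrange-ordered τ node 1+a<b (traversal-ordered left) (traversal-ordered right)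
         (λ ps∈ p∈ → traversal-within left ps∈ p∈) (λ ps∈ p∈ → traversal-within right ps∈ p∈))
    where
    left = leftChild node 1+a<b
    right = rightChild node 1+a<b

  candidateLists : List (List ℕ)
  candidateLists = (0 ∷ []) ∷ traversal N 0 last 0 aLow-cTop ++ (last ∷ []) ∷ []

  candidateLists-ordered : AllPairs SameLevelOrdered candidateLists
  candidateLists-ordered =
    All.tabulate (λ _ → λ { (here refl) _ _ → z≤n })
    ∷ AllPairs-++⁺ (traversal-ordered root) ([] ∷ [])
        λ { ps∈ (here refl) p∈ (here refl) _ → proj₂ (traversal-within root ps∈ p∈) }

  last-position : ∀ {p} → p < N → p ≤ last
  last-position p<N = ≤-pred (subst (_ <_) n≡1+last p<N)

  maximal-candidate : ∀ C → IsMaximalClique G C → positions C ∈ₗ candidateLists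
  maximal-candidate C (clique , maximal)
    with positions C | positions-increasing C | ∈-positions⁺ {C} | ∈-positions⁻ {C}
  ... | [] | _ | members | _ with at 0 Subsetₚ.∈? C
  ...   | yes at0∈ = contradiction (members at0∈) ¬Any[]
  ...   | no at0∉  = contradiction (members (proj₁ (proj₂ (maximal (at 0) at0∉)))) ¬Any[]
  maximal-candidate C (clique , maximal)
      | x ∷ [] | _ | _ | ∈C with x ≟ 0 | x ≟ last
  ... | yes refl | _        = here refl
  ... | no _     | yes refl = there (∈-++⁺ʳ _ (here refl))
  ... | no x≢0   | no x≢last =
    there (∈-++⁺ˡ (apex∈traversal root (n≢0⇒n>0 x≢0) (≤∧≢⇒< (last-position (proj₁ (∈C (here refl)))) x≢last)))
  maximal-candidate C (clique , maximal)
      | x ∷ y ∷ [] | (x<y ∷ []) ∷ _ | _ | ∈C =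
    let _ , _ , _ , node , node⊆ = chord-node root z≤n x<y (last-position (proj₁ (∈C (there (here refl)))))
                                     (clique-at-adjacent clique (∈C (here refl)) (∈C (there (here refl))) x<y)
    in there (∈-++⁺ˡ (node⊆ (chord∈traversal node)))
  maximal-candidate C (clique , maximal)
      | x ∷ y ∷ z ∷ [] | (x<y ∷ x<z ∷ []) ∷ (y<z ∷ []) ∷ _ | _ | ∈C =
    let f′ , m′ , τ′ , node , node⊆ = chord-node root z≤n x<z (last-position z<N) (adjacent x∈ z∈ x<z)
    in there (∈-++⁺ˡ (node⊆ (subst (λ c → (x ∷ c ∷ z ∷ []) ∈ₗ traversal f′ x z m′ τ′)
                                   (apex-triangle x<y y<z z<N (adjacent x∈ y∈ x<y) (adjacent y∈ z∈ y<z))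
                                   (triangle∈traversal node (≤-<-trans x<y y<z)))))
    where
    x∈ = here refl
    y∈ = there (here refl)
    z∈ = there (there (here refl))
    z<N = proj₁ (∈C z∈)
    adjacent = λ {p} {q} p∈ q∈ → clique-at-adjacent {C} {p} {q} clique (∈C p∈) (∈C q∈)
  maximal-candidate C (clique , maximal)
      | x ∷ y ∷ z ∷ w ∷ _ | (x<y ∷ x<z ∷ x<w ∷ _) ∷ (y<z ∷ y<w ∷ _) ∷ (z<w ∷ _) ∷ _ | _ | ∈C =
    ⊥-elim (chords-cross-free x<y y<z z<w (proj₁ (∈C w∈)) (adjacent x∈ z∈ x<z) (adjacent y∈ w∈ y<w))
    where
    x∈ = here refl
    y∈ = there (here refl)
    z∈ = there (there (here refl))
    w∈ = there (there (there (here refl)))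
    adjacent = λ {p} {q} p∈ q∈ → clique-at-adjacent {C} {p} {q} clique (∈C p∈) (∈C q∈)

  levelsOf : Subset (n G) → List ℕ
  levelsOf X = map level (positions X)

  -- The maximum only serves as the value for the empty set.
  minLevel : Subset (n G) → ℕ
  minLevel X = min (max 0 (levelsOf X)) (levelsOf X)

  -- Blocks of two consecutive levels; a clique lies in levels 2 B, …, 2 B + 3 of its block B.
  block : Subset (n G) → ℕ
  block X = minLevel X / 2

  class : Subset (n G) → Fin 2
  class X = block X mod 2

  level∈levelsOf : ∀ {X u} → u ∈ X → vertexLevel u ∈ₗ levelsOf X
  level∈levelsOf u∈ = ∈-map⁺ level (∈-positions⁺ u∈)

  minLevel≤ : ∀ {X u} → u ∈ X → minLevel X ≤ vertexLevel u
  minLevel≤ {X} u∈ = All.lookup (min≤xs (max 0 (levelsOf X)) (levelsOf X)) (level∈levelsOf u∈)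

  clique-levels-close : ∀ {X u w} → IsClique G X → u ∈ X → w ∈ X → vertexLevel u ≤ 2 + vertexLevel w
  clique-levels-close {u = u} {w} clique u∈ w∈ with u Fin.≟ w
  ... | yes refl = m≤n+m _ 2
  ... | no u≢w   = proj₂ (edge-level-bounds (clique w u w∈ u∈ λ w≡u → u≢w (sym w≡u)))

  ≤2+minLevel : ∀ {X u} → IsClique G X → u ∈ X → vertexLevel u ≤ 2 + minLevel X
  ≤2+minLevel {X} {u} clique u∈ = ≤-trans (m≤n+m∸n (vertexLevel u) 2) (+-monoʳ-≤ 2 (v≤min⁺ below-top below-all))
    where
    below-top : vertexLevel u ∸ 2 ≤ max 0 (levelsOf X)
    below-top = ≤-trans (m∸n≤m _ 2) (All.lookup (xs≤max 0 (levelsOf X)) (level∈levelsOf u∈))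
    below-all : All (vertexLevel u ∸ 2 ≤_) (levelsOf X)
    below-all = Allₚ.map⁺ (All.tabulate λ p∈ → m≤n+o⇒m∸n≤o _ 2
      (subst (λ l → vertexLevel u ≤ 2 + l) (cong level (pos-at-positions p∈))
             (clique-levels-close clique u∈ (proj₂ (∈-positions⁻ p∈)))))

  block-lower : ∀ {X u} → u ∈ X → block X * 2 ≤ vertexLevel u
  block-lower {X} u∈ = ≤-trans (m/n*n≤m (minLevel X) 2) (minLevel≤ u∈)

  block-upper : ∀ {X u} → IsClique G X → u ∈ X → vertexLevel u ≤ 3 + block X * 2
  block-upper {X} clique u∈ = ≤-trans (≤2+minLevel clique u∈) (+-monoʳ-≤ 2 (begin
    minLevel X                    ≡⟨ m≡m%n+[m/n]*n (minLevel X) 2 ⟩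
    minLevel X % 2 + block X * 2  ≤⟨ +-monoˡ-≤ (block X * 2) (≤-pred (m%n<n (minLevel X) 2)) ⟩
    1 + block X * 2               ∎))
    where open ≤-Reasoning

  same-block-precedes : ∀ {X Y} → IsClique G X → IsClique G Y → block X ≡ block Y →
                        (∀ {u w} → u ∈ X → w ∈ Y → vertexLevel u ≡ vertexLevel w → pos u ≤ pos w) →
                        Precedes L X Y
  same-block-precedes {X} {Y} clique-X clique-Y same ordered = precedes-nearby crossingFree close ranked
    where
    close : ∀ {u w} → u ∈ X → w ∈ Y → vertexLevel u < 5 + vertexLevel w × vertexLevel w < 5 + vertexLevel u
    close {u} {w} u∈ w∈ =
      ≤-<-trans (≤-trans (block-upper clique-X u∈) (+-monoʳ-≤ 3 (subst (λ B → B * 2 ≤ vertexLevel w) (sym same) (block-lower w∈))))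
                (+-monoˡ-< (vertexLevel w) 3<5) ,
      ≤-<-trans (≤-trans (block-upper clique-Y w∈) (+-monoʳ-≤ 3 (subst (λ B → B * 2 ≤ vertexLevel u) same (block-lower u∈))))
                (+-monoˡ-< (vertexLevel u) 3<5)
      where
      3<5 : 3 < 5
      3<5 = s≤s (s≤s (s≤s (s≤s z≤n)))
    ranked : ∀ {u w} → u ∈ X → w ∈ Y → vertexLevel u ≡ vertexLevel w → rankOf u ≤ rankOf w
    ranked {u} u∈ w∈ same-level = subst (λ l → rankOf u ≤ l * N + _) same-level
                                    (+-monoʳ-≤ (vertexLevel u * N) (ordered u∈ w∈ same-level))

  lower-block-precedes : ∀ {X Y} → IsClique G X → block X + 2 ≤ block Y → Precedes L X Y
  lower-block-precedes {X} {Y} clique-X gap = precedes-below crossingFree λ {u} {w} u∈ w∈ → begin-strict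
    vertexLevel u          ≤⟨ block-upper clique-X u∈ ⟩
    3 + block X * 2        <⟨ ≤-refl ⟩
    4 + block X * 2        ≡⟨ +-comm 4 (block X * 2) ⟩
    block X * 2 + 2 * 2    ≡⟨ *-distribʳ-+ 2 (block X) 2 ⟨
    (block X + 2) * 2      ≤⟨ *-monoˡ-≤ 2 gap ⟩
    block Y * 2            ≤⟨ block-lower w∈ ⟩
    vertexLevel w          ∎
    where open ≤-Reasoning

  open BucketSort block

  candidates : List (Subset (n G))
  candidates = bucketSort (map atPositions candidateLists)

  colorable : CliqueColorable L 2
  colorable = cliqueColorable L 2 class candidates complete
    (bucketSort-AllPairs (AllPairsₚ.map⁺ (AllPairs.map sameBlock candidateLists-ordered)) lowerBlock)
    where
    complete : ∀ C → IsMaximalClique G C → C ∈ₗ candidates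
    complete C maxC = ∈-bucketSort⁺ (subst (_∈ₗ _) (atPositions-positions C)
                                      (∈-map⁺ atPositions (maximal-candidate C maxC)))
    sameBlock : ∀ {ps qs} → SameLevelOrdered ps qs → block (atPositions ps) ≡ block (atPositions qs) →
                SameClassPrecedes L class (atPositions ps) (atPositions qs)
    sameBlock {ps} {qs} ordered same (clique-X , _) (clique-Y , _) _ =
      same-block-precedes clique-X clique-Y same
        λ u∈ w∈ same-level → ordered (∈-atPositions⁻ ps u∈) (∈-atPositions⁻ qs w∈) same-level
    lowerBlock : ∀ {X Y} → block X < block Y → SameClassPrecedes L class X Y
    lowerBlock bX<bY (clique-X , _) _ same-class = lower-block-precedes clique-X (mod-gap 2 same-class bX<bY)

outerplanar-layout : (G : Graph) → IsOuterplanar G → Σ (TrackLayout G 5) λ L → CliqueColorable L 2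
outerplanar-layout G (π , π-bij , no-crossing) with n G ≤? 1
... | yes n≤1 = ≤1-vertex-layout G n≤1
... | no n≰1  = L , colorable
  where
  1≤n : 1 ≤ n G
  1≤n = <⇒≤ (≰⇒> n≰1)
  open OuterplanarLayout G π π-bij no-crossing (n G ∸ 1) (sym (m+[n∸m]≡n 1≤n)) (∸-monoˡ-≤ 1 (≰⇒> n≰1))

lemma4 : ((G : Graph) → IsPath G → Σ (TrackLayout G 2) λ L → CliqueColorable L 1)
       × ((G : Graph) → IsTree G → Σ (TrackLayout G 3) λ L → CliqueColorable L 2)
       × ((G : Graph) → IsOuterplanar G → Σ (TrackLayout G 5) λ L → CliqueColorable L 2)
lemma4 = path-layout , tree-layout , outerplanar-layout
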